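{- Let $r\ge 1$ and let $1\le m_1\le m_2$ be integers. For $i=1,2$ write $m_i=a_i\binom{r+1}{2}+b_i$ with $0\le b_i<\binom{r+1}{2}$ and let $G_i=a_iK_{r+1}\cup\mathcal{C}(b_i)$. Let $m=m_1+m_2=a\binom{r+1}{2}+b$ with $0\le b<\binom{r+1}{2}$, and let $G=aK_{r+1}\cup\mathcal{C}(b)$. Then $\kappa(G)\ge\kappa(G_1)+\kappa(G_2)$, with strict inequality unless $G_1\cup G_2$ is, disregarding isolated vertices, isomorphic to $aK_{r+1}\cup\mathcal{C}(b)$, or $b=\binom{c}{2}+1$ for some integer $c\ge 2$ and $G_1\cup G_2$ is isomorphic to $aK_{r+1}\cup K_c\cup K_2$.
   Context: $\kappa(H)$ is the number of cliques of a graph $H$ with at least $2$ vertices. $\cup$ is disjoint union; $aK_{r+1}$ is $a$ disjoint copies of $K_{r+1}$. The colex graph $\mathcal{C}(n)$ is the graph on the positive integers whose edges are the first $n$ pairs $\{i<j\}$ in the order where $\{i<j\}$ precedes $\{i'<j'\}$ iff $j<j'$ or ($j=j'$ and $i<i'$); up to isolated vertices, if $n=\binom{c}{2}+d$ with $0\le d<c$, it is a clique on $c$ vertices plus one vertex adjacent to $d$ vertices of the clique. -}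

module Defs where

open import Data.Bool using (Bool; true; false; _∧_; _∨_; not; if_then_else_; T)
open import Data.Nat using (ℕ; zero; suc; _+_; _≤ᵇ_; _<ᵇ_)
open import Data.Nat.Combinatorics using (_C_)
open import Data.Fin using (Fin; toℕ; splitAt; _≟_)
open import Data.Fin.Subset using (Subset; _∈_)
open import Data.Vec using (Vec; []; _∷_; lookup)
open import Data.List using (List; []; _∷_; map; _++_; allFin)
open import Data.Nat.ListAction using (sum)
open import Data.Bool.ListAction using (all; any)
open import Data.Sum using (_⊎_; inj₁; inj₂)
open import Data.Product using (Σ; proj₁)
open import Relation.Nullary.Decidable using (⌊_⌋)
open import Relation.Binary.PropositionalEquality using (_≡_)
open import Function.Bundles using (_↔_; Inverse)

record Graph : Set where
  constructor mkGraph
  field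
    n   : ℕ
    adj : Fin n → Fin n → Bool
open Graph public

subsets : (k : ℕ) → List (Vec Bool k)
subsets zero = [] ∷ []
subsets (suc k) = map (true ∷_) (subsets k) ++ map (false ∷_) (subsets k)

size : ∀ {k} → Vec Bool k → ℕ
size [] = 0
size (true ∷ s) = suc (size s)
size (false ∷ s) = size s

isClique≥2 : (G : Graph) → Vec Bool (n G) → Bool
isClique≥2 G S =
  (2 ≤ᵇ size S) ∧
  all (λ u → all (λ v → not (lookup S u ∧ lookup S v ∧ not ⌊ u ≟ v ⌋) ∨ adj G u v)
                 (allFin (n G)))
      (allFin (n G))

κ : Graph → ℕ
κ G = sum (map (λ S → if isClique≥2 G S then 1 else 0) (subsets (n G)))

⊕adj : ∀ {p q} → (Fin p → Fin p → Bool) → (Fin q → Fin q → Bool)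
     → Fin p ⊎ Fin q → Fin p ⊎ Fin q → Bool
⊕adj a b (inj₁ i) (inj₁ j) = a i j
⊕adj a b (inj₂ i) (inj₂ j) = b i j
⊕adj a b _ _ = false

infixr 5 _⊕_
_⊕_ : Graph → Graph → Graph
G ⊕ H = mkGraph (n G + n H) (λ x y → ⊕adj (adj G) (adj H) (splitAt (n G) x) (splitAt (n G) y))

emptyGraph : Graph
emptyGraph = mkGraph 0 (λ _ _ → false)

copies : ℕ → Graph → Graph
copies zero H = emptyGraph
copies (suc a) H = H ⊕ copies a H

K : ℕ → Graph
K k = mkGraph k (λ i j → not ⌊ i ≟ j ⌋)

-- colex graph C(b): vertices 0..b (0-indexed; all others isolated), the pair
-- {i<j} has colex rank (j choose 2) + i, and it is an edge iff its rank < b.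
colexAdj : ℕ → ℕ → ℕ → Bool
colexAdj b i j =
  if i <ᵇ j then (j C 2) + i <ᵇ b
  else if j <ᵇ i then (i C 2) + j <ᵇ b
  else false

Colex : ℕ → Graph
Colex b = mkGraph (suc b) (λ i j → colexAdj b (toℕ i) (toℕ j))

nonIsolated : (G : Graph) → Fin (n G) → Bool
nonIsolated G v = any (adj G v) (allFin (n G))

NI : Graph → Set
NI G = Σ (Fin (n G)) (λ v → T (nonIsolated G v))

IsoUpToIsolated : Graph → Graph → Set
IsoUpToIsolated G H =
  Σ (NI G ↔ NI H) λ φ →
    ∀ (u v : NI G) →
      adj G (proj₁ u) (proj₁ v) ≡ adj H (proj₁ (Inverse.to φ u)) (proj₁ (Inverse.to φ v))

-- Cliques are counted by recursion on the first vertex (cliques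
--     avoiding it, plus cliques of its neighbourhood); this gives κ(G ⊕ H) = κG + κH
--     and κ(aH) = a·κH.
--  2. Staircase graphs: a clique on c vertices plus a vertex joined to d < c of them
--     has 2^c + 2^d − c − 2 cliques.  K_k and every colex graph C(tri c + d), where
--     tri c = (c choose 2), are staircases.
--  3. Colex weights.  Edge t of the colex order lies in some column u and creates 2^u
--     new cliques, so κ(C(b)) = ℱ b, the total weight of the first b edges.
--  4. Lower bounds for windows (runs of consecutive weights) via convexity of 2^,
--     giving superadditivity ℱ x + ℱ y ≤ ℱ (x + y), strict unless x = 0 or
--     (x, y) = (1, tri c) with c ≥ 2.
--  5. Upper bounds for windows inside K_(r+1), giving that a carry is profitable:
--     ℱ b₁ + ℱ b₂ < ℱ (tri (r+1)) + ℱ e when b₁ + b₂ = tri (r+1) + e, b₁, b₂ < tri (r+1).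
--  6. Isomorphisms up to isolated vertices, from the symmetric monoidal structure of
--     disjoint union; they realise the equality cases of 4 as the exceptional ones.
--  7. The theorem: κ(aK_R ∪ C(b)) = a·ℱ(tri R) + ℱ b, and a case split on whether
--     b₁ + b₂ overflows tri (r+1).
module Submission where

open import Defs
open import Data.Nat using (ℕ; zero; suc; _+_; _*_; _∸_; _^_; _≤_; _<_; _≥_; _>_; _≤ᵇ_; _<ᵇ_; _≡ᵇ_; pred; z≤n; s≤s)
open import Data.Nat.Properties hiding (_≟_)
open import Data.Nat.Combinatorics using (_C_; nCk+nC[k+1]≡[n+1]C[k+1]; nC1≡n)
open import Data.Nat.ListAction using (sum)
open import Data.Nat.ListAction.Properties using (sum-++)
open import Data.Nat.Tactic.RingSolver using (solve-∀)
open import Data.Bool using (Bool; true; false; _∧_; _∨_; not; if_then_else_; T)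
open import Data.Bool.Properties using (∧-identityʳ; ∧-zeroʳ; ∨-zeroʳ; ∨-identityʳ; ∧-assoc; ∧-comm; ∨-assoc; T-irrelevant; ∧-commutativeMonoid)
open import Data.Bool.ListAction using (all; any)
open import Data.Fin using (Fin; toℕ; splitAt; join; _↑ˡ_; _↑ʳ_; _≟_; fromℕ<; inject≤) renaming (zero to fz; suc to fs)
open import Data.Fin.Properties using (splitAt-↑ˡ; splitAt-↑ʳ; splitAt-join; join-splitAt; toℕ-fromℕ<; toℕ-inject≤; toℕ-injective; toℕ<n)
open import Data.Vec using (Vec; []; _∷_; lookup)
open import Data.List using (List; []; _∷_; map; _++_; allFin; tabulate)
open import Data.List.Properties using (map-++; map-∘; map-cong)
open import Data.Sum using (_⊎_; inj₁; inj₂; [_,_]′; map₁; swap; assocʳ; assocˡ) renaming (map to map⊎)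
open import Data.Sum.Properties using (swap-involutive)
open import Data.Product using (Σ; _,_; proj₁; proj₂; _×_)
open import Data.Empty using (⊥; ⊥-elim)
open import Data.Unit using (tt)
open import Relation.Nullary using (¬_; yes; no)
open import Relation.Nullary.Decidable using (⌊_⌋)
open import Relation.Binary using (tri<; tri≈; tri>)
open import Relation.Binary.PropositionalEquality
open import Function using (_∘_; id)
open import Function.Bundles using (mk↔ₛ′)
open import Algebra.Bundles using (CommutativeMonoid)
open import Algebra.Properties.CommutativeSemigroup (CommutativeMonoid.commutativeSemigroup ∧-commutativeMonoid)
  using () renaming (interchange to ∧-interchange)

-- 1. Clique counting

andFin : (k : ℕ) → (Fin k → Bool) → Bool
andFin zero g = true
andFin (suc k) g = g fz ∧ andFin k (g ∘ fs)

orFin : (k : ℕ) → (Fin k → Bool) → Bool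
orFin zero g = false
orFin (suc k) g = g fz ∨ orFin k (g ∘ fs)

all-tabulate : ∀ k (g : Fin k → Bool) {B : Set} (p : B → Bool) (h : Fin k → B) →
  (∀ i → p (h i) ≡ g i) → all p (tabulate h) ≡ andFin k g
all-tabulate zero g p h e = refl
all-tabulate (suc k) g p h e = cong₂ _∧_ (e fz) (all-tabulate k (g ∘ fs) p (h ∘ fs) (e ∘ fs))

all-allFin : ∀ k (g : Fin k → Bool) → all g (allFin k) ≡ andFin k g
all-allFin k g = all-tabulate k g g id (λ _ → refl)

any-tabulate : ∀ k (g : Fin k → Bool) {B : Set} (p : B → Bool) (h : Fin k → B) →
  (∀ i → p (h i) ≡ g i) → any p (tabulate h) ≡ orFin k g
any-tabulate zero g p h e = refl
any-tabulate (suc k) g p h e = cong₂ _∨_ (e fz) (any-tabulate k (g ∘ fs) p (h ∘ fs) (e ∘ fs))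

any-allFin : ∀ k (g : Fin k → Bool) → any g (allFin k) ≡ orFin k g
any-allFin k g = any-tabulate k g g id (λ _ → refl)

andFin-cong : ∀ k {g h : Fin k → Bool} → (∀ i → g i ≡ h i) → andFin k g ≡ andFin k h
andFin-cong zero e = refl
andFin-cong (suc k) e = cong₂ _∧_ (e fz) (andFin-cong k (e ∘ fs))

orFin-cong : ∀ k {g h : Fin k → Bool} → (∀ i → g i ≡ h i) → orFin k g ≡ orFin k h
orFin-cong zero e = refl
orFin-cong (suc k) e = cong₂ _∨_ (e fz) (orFin-cong k (e ∘ fs))

andFin-true : ∀ k → andFin k (λ _ → true) ≡ true
andFin-true zero = refl
andFin-true (suc k) = andFin-true k

orFin-false : ∀ k → orFin k (λ _ → false) ≡ false
orFin-false zero = refl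
orFin-false (suc k) = orFin-false k

andFin-∧ : ∀ k (g h : Fin k → Bool) → andFin k (λ i → g i ∧ h i) ≡ andFin k g ∧ andFin k h
andFin-∧ zero g h = refl
andFin-∧ (suc k) g h = trans (cong ((g fz ∧ h fz) ∧_) (andFin-∧ k (g ∘ fs) (h ∘ fs)))
  (∧-interchange (g fz) (h fz) (andFin k (g ∘ fs)) (andFin k (h ∘ fs)))

tailAdj : ∀ {k} → (Fin (suc k) → Fin (suc k) → Bool) → Fin k → Fin k → Bool
tailAdj A i j = A (fs i) (fs j)

link₀ : ∀ {k} → (Fin (suc k) → Fin (suc k) → Bool) → Fin k → Bool
link₀ A v = A fz (fs v) ∧ A (fs v) fz

-- cliques k A M t: the number of cliques S of A with |S| ≥ t contained in the
-- mask M.  A clique either avoids vertex 0, or is {0} plus a clique of its link.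
cliques : (k : ℕ) → (Fin k → Fin k → Bool) → (Fin k → Bool) → ℕ → ℕ
cliques zero A M zero = 1
cliques zero A M (suc t) = 0
cliques (suc k) A M t = cliques k (tailAdj A) (M ∘ fs) t
  + (if M fz then cliques k (tailAdj A) (λ v → M (fs v) ∧ link₀ A v) (pred t) else 0)

cliques-cong : ∀ k {A A' : Fin k → Fin k → Bool} {M M' : Fin k → Bool} t →
  (∀ i j → A i j ≡ A' i j) → (∀ i → M i ≡ M' i) → cliques k A M t ≡ cliques k A' M' t
cliques-cong zero zero eA eM = refl
cliques-cong zero (suc t) eA eM = refl
cliques-cong (suc k) {A} {A'} {M} {M'} t eA eM rewrite eM fz =
  cong₂ _+_ (cliques-cong k t (λ i j → eA (fs i) (fs j)) (eM ∘ fs))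
    (cong (λ b → if M' fz then b else 0) (cliques-cong k (pred t) (λ i j → eA (fs i) (fs j))
       (λ v → cong₂ _∧_ (eM (fs v)) (cong₂ _∧_ (eA fz (fs v)) (eA (fs v) fz)))))

pairOK : ∀ {k} → (Fin k → Fin k → Bool) → Vec Bool k → Fin k → Fin k → Bool
pairOK A S u v = not (lookup S u ∧ lookup S v ∧ not ⌊ u ≟ v ⌋) ∨ A u v

cliqueᵇ : ∀ {k} → (Fin k → Fin k → Bool) → Vec Bool k → Bool
cliqueᵇ {k} A S = all (λ u → all (pairOK A S u) (allFin k)) (allFin k)

insideᵇ : ∀ {k} → Vec Bool k → (Fin k → Bool) → Bool
insideᵇ {k} S M = all (λ u → not (lookup S u) ∨ M u) (allFin k)

counted : ∀ k → (Fin k → Fin k → Bool) → (Fin k → Bool) → ℕ → Vec Bool k → Bool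
counted k A M t S = ((t ≤ᵇ size S) ∧ cliqueᵇ A S) ∧ insideᵇ S M

indicator : ∀ k → (Fin k → Fin k → Bool) → (Fin k → Bool) → ℕ → Vec Bool k → ℕ
indicator k A M t S = if counted k A M t S then 1 else 0

-- The same tests as Fin-folds, which can be split at vertex 0.
cliqueF : ∀ {k} → (Fin k → Fin k → Bool) → Vec Bool k → Bool
cliqueF {k} A S = andFin k (λ u → andFin k (pairOK A S u))

insideF : ∀ {k} → Vec Bool k → (Fin k → Bool) → Bool
insideF {k} S M = andFin k (λ u → not (lookup S u) ∨ M u)

counted≡ : ∀ k A M t S → counted k A M t S ≡ ((t ≤ᵇ size S) ∧ cliqueF A S) ∧ insideF S M
counted≡ k A M t S = cong₂ (λ a b → ((t ≤ᵇ size S) ∧ a) ∧ b)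
  (all-tabulate k _ _ id (λ u → all-allFin k _)) (all-allFin k _)

row-tail : ∀ {k} (A : Fin (suc k) → Fin (suc k) → Bool) (S : Vec Bool k) u →
  andFin k (λ v → not (lookup S u ∧ lookup S v ∧ not ⌊ fs u ≟ fs v ⌋) ∨ A (fs u) (fs v))
  ≡ andFin k (pairOK (tailAdj A) S u)
row-tail {k} A S u = andFin-cong k (λ v → cong (λ z → not (lookup S u ∧ lookup S v ∧ not z) ∨ A (fs u) (fs v)) (≟-fs u v))
  where
  ≟-fs : ∀ (u v : Fin k) → ⌊ fs u ≟ fs v ⌋ ≡ ⌊ u ≟ v ⌋
  ≟-fs u v with u ≟ v
  ... | yes _ = refl
  ... | no _ = refl

cliqueF-false∷ : ∀ {k} (A : Fin (suc k) → Fin (suc k) → Bool) S → cliqueF A (false ∷ S) ≡ cliqueF (tailAdj A) S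
cliqueF-false∷ {k} A S = cong₂ _∧_ (andFin-true k) (andFin-cong k (λ u → cong₂ _∧_ (vacuous (lookup S u)) (row-tail A S u)))
  where
  vacuous : ∀ {u} s → not (s ∧ false ∧ true) ∨ A (fs u) fz ≡ true
  vacuous true = refl
  vacuous false = refl

cliqueF-true∷ : ∀ {k} (A : Fin (suc k) → Fin (suc k) → Bool) S →
  cliqueF A (true ∷ S) ≡ cliqueF (tailAdj A) S ∧ insideF S (link₀ A)
cliqueF-true∷ {k} A S = begin
    X ∧ andFin k (λ u → Y u ∧ R' u)
  ≡⟨ cong (X ∧_) (andFin-cong k (λ u → cong (Y u ∧_) (row-tail A S u))) ⟩
    X ∧ andFin k (λ u → Y u ∧ R u)
  ≡⟨ cong (X ∧_) (andFin-∧ k Y R) ⟩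
    X ∧ (andFin k Y ∧ andFin k R)
  ≡⟨ sym (∧-assoc X _ _) ⟩
    (X ∧ andFin k Y) ∧ andFin k R
  ≡⟨ cong (_∧ andFin k R) (trans (sym (andFin-∧ k _ Y)) (andFin-cong k (λ v → both (lookup S v) _ _))) ⟩
    insideF S (link₀ A) ∧ cliqueF (tailAdj A) S
  ≡⟨ ∧-comm (insideF S (link₀ A)) (cliqueF (tailAdj A) S) ⟩
    cliqueF (tailAdj A) S ∧ insideF S (link₀ A) ∎
  where
  open ≡-Reasoning
  X : Bool
  X = andFin k (λ v → not (lookup S v ∧ true) ∨ A fz (fs v))
  Y : Fin k → Bool
  Y = λ u → not (lookup S u ∧ true) ∨ A (fs u) fz
  R : Fin k → Bool
  R = λ u → andFin k (pairOK (tailAdj A) S u)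
  R' : Fin k → Bool
  R' = λ u → andFin k (λ v → not (lookup S u ∧ lookup S v ∧ not ⌊ fs u ≟ fs v ⌋) ∨ A (fs u) (fs v))
  both : ∀ s a b → (not (s ∧ true) ∨ a) ∧ (not (s ∧ true) ∨ b) ≡ not s ∨ (a ∧ b)
  both true a b = refl
  both false a b = refl

insideF-∧ : ∀ {k} S (M N : Fin k → Bool) → insideF S M ∧ insideF S N ≡ insideF S (λ v → M v ∧ N v)
insideF-∧ {k} S M N = trans (sym (andFin-∧ k _ _)) (andFin-cong k (λ v → both (lookup S v) _ _))
  where
  both : ∀ s a b → (not s ∨ a) ∧ (not s ∨ b) ≡ not s ∨ (a ∧ b)
  both true a b = refl
  both false a b = refl

counted-false∷ : ∀ k A M t S → counted (suc k) A M t (false ∷ S) ≡ counted k (tailAdj A) (M ∘ fs) t S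
counted-false∷ k A M t S = trans (counted≡ (suc k) A M t (false ∷ S))
  (trans (cong (λ a → ((t ≤ᵇ size S) ∧ a) ∧ insideF S (M ∘ fs)) (cliqueF-false∷ A S))
    (sym (counted≡ k (tailAdj A) (M ∘ fs) t S)))

≤ᵇ-suc : ∀ t n → (t ≤ᵇ suc n) ≡ (pred t ≤ᵇ n)
≤ᵇ-suc zero n = refl
≤ᵇ-suc (suc zero) n = refl
≤ᵇ-suc (suc (suc t)) n = refl

counted-true∷ : ∀ k A M t S → counted (suc k) A M t (true ∷ S)
  ≡ M fz ∧ counted k (tailAdj A) (λ v → M (fs v) ∧ link₀ A v) (pred t) S
counted-true∷ k A M t S = trans (counted≡ (suc k) A M t (true ∷ S))
  (trans (cong₂ (λ a c → (a ∧ c) ∧ (M fz ∧ insideF S (M ∘ fs))) (≤ᵇ-suc t (size S)) (cliqueF-true∷ A S))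
  (trans (shuffle (pred t ≤ᵇ size S) (cliqueF (tailAdj A) S) (insideF S (link₀ A)) (M fz) (insideF S (M ∘ fs)))
  (trans (cong (λ z → M fz ∧ ((pred t ≤ᵇ size S) ∧ cliqueF (tailAdj A) S) ∧ z) (insideF-∧ S (M ∘ fs) (link₀ A)))
   (cong (M fz ∧_) (sym (counted≡ k (tailAdj A) _ (pred t) S))))))
  where
  shuffle : ∀ a c n m s → (a ∧ (c ∧ n)) ∧ (m ∧ s) ≡ m ∧ ((a ∧ c) ∧ (s ∧ n))
  shuffle a c n false s = ∧-zeroʳ _
  shuffle false c n true s = refl
  shuffle true false n true s = refl
  shuffle true true false true s = sym (∧-zeroʳ s)
  shuffle true true true true s = sym (∧-identityʳ s)

sum-zeros : ∀ {B : Set} (xs : List B) → sum (map (λ _ → 0) xs) ≡ 0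
sum-zeros [] = refl
sum-zeros (x ∷ xs) = sum-zeros xs

sum-if : ∀ {B : Set} (m : Bool) (g : B → ℕ) xs →
  sum (map (λ S → if m then g S else 0) xs) ≡ (if m then sum (map g xs) else 0)
sum-if true g xs = refl
sum-if false g xs = sum-zeros xs

sum-map-++ : ∀ {B : Set} (g : B → ℕ) xs ys → sum (map g (xs ++ ys)) ≡ sum (map g xs) + sum (map g ys)
sum-map-++ g xs ys = trans (cong sum (map-++ g xs ys)) (sum-++ (map g xs) (map g ys))

sum-indicator≡cliques : ∀ k A M t → sum (map (indicator k A M t) (subsets k)) ≡ cliques k A M t
sum-indicator≡cliques zero A M zero = refl
sum-indicator≡cliques zero A M (suc t) = refl
sum-indicator≡cliques (suc k) A M t = begin
    sum (map ind (map (true ∷_) ss ++ map (false ∷_) ss))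
  ≡⟨ sum-map-++ ind (map (true ∷_) ss) (map (false ∷_) ss) ⟩
    sum (map ind (map (true ∷_) ss)) + sum (map ind (map (false ∷_) ss))
  ≡⟨ cong₂ _+_ (cong sum (sym (map-∘ ss))) (cong sum (sym (map-∘ ss))) ⟩
    sum (map (ind ∘ (true ∷_)) ss) + sum (map (ind ∘ (false ∷_)) ss)
  ≡⟨ cong₂ _+_ (cong sum (map-cong with0 ss)) (cong sum (map-cong without0 ss)) ⟩
    sum (map (λ S → if M fz then indicator k (tailAdj A) L (pred t) S else 0) ss) + sum (map (indicator k (tailAdj A) (M ∘ fs) t) ss)
  ≡⟨ cong₂ _+_ (sum-if (M fz) _ ss) (sum-indicator≡cliques k (tailAdj A) (M ∘ fs) t) ⟩
    (if M fz then sum (map (indicator k (tailAdj A) L (pred t)) ss) else 0) + cliques k (tailAdj A) (M ∘ fs) t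
  ≡⟨ cong (λ z → (if M fz then z else 0) + cliques k (tailAdj A) (M ∘ fs) t) (sum-indicator≡cliques k (tailAdj A) L (pred t)) ⟩
    (if M fz then cliques k (tailAdj A) L (pred t) else 0) + cliques k (tailAdj A) (M ∘ fs) t
  ≡⟨ +-comm (if M fz then cliques k (tailAdj A) L (pred t) else 0) _ ⟩
    cliques (suc k) A M t ∎
  where
  open ≡-Reasoning
  ind : Vec Bool (suc k) → ℕ
  ind = indicator (suc k) A M t
  ss : List (Vec Bool k)
  ss = subsets k
  L : Fin k → Bool
  L = λ v → M (fs v) ∧ link₀ A v
  if-∧ : ∀ m c → (if m ∧ c then 1 else 0) ≡ (if m then (if c then 1 else 0) else 0)
  if-∧ true c = refl
  if-∧ false c = refl
  with0 : ∀ S → ind (true ∷ S) ≡ (if M fz then indicator k (tailAdj A) L (pred t) S else 0)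
  with0 S = trans (cong (λ b → if b then 1 else 0) (counted-true∷ k A M t S)) (if-∧ (M fz) _)
  without0 : ∀ S → ind (false ∷ S) ≡ indicator k (tailAdj A) (M ∘ fs) t S
  without0 S = cong (λ b → if b then 1 else 0) (counted-false∷ k A M t S)

everywhere : ∀ {k} → Fin k → Bool
everywhere _ = true

κ≡cliques : ∀ G → κ G ≡ cliques (n G) (adj G) everywhere 2
κ≡cliques G = trans (cong sum (map-cong unmasked (subsets (n G)))) (sum-indicator≡cliques (n G) (adj G) everywhere 2)
  where
  insideF-everywhere : ∀ S → insideF S everywhere ≡ true
  insideF-everywhere S = trans (andFin-cong (n G) (λ u → ∨-zeroʳ (not (lookup S u)))) (andFin-true (n G))
  unmasked : ∀ S → (if isClique≥2 G S then 1 else 0) ≡ indicator (n G) (adj G) everywhere 2 S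
  unmasked S = cong (λ b → if b then 1 else 0) (sym (trans
    (cong (λ z → ((2 ≤ᵇ size S) ∧ cliqueᵇ (adj G) S) ∧ z) (trans (all-allFin (n G) _) (insideF-everywhere S)))
    (∧-identityʳ _)))

countFin : ∀ k → (Fin k → Bool) → ℕ
countFin zero M = 0
countFin (suc k) M = (if M fz then 1 else 0) + countFin k (M ∘ fs)

cliques-≥0 : ∀ k A M → cliques k A M 0 ≡ suc (cliques k A M 1)
cliques-≥0 zero A M = refl
cliques-≥0 (suc k) A M rewrite cliques-≥0 k (tailAdj A) (M ∘ fs) = refl

cliques-≥1 : ∀ k A M → cliques k A M 1 ≡ cliques k A M 2 + countFin k M
cliques-≥1 zero A M = refl
cliques-≥1 (suc k) A M with M fz
... | true rewrite cliques-≥1 k (tailAdj A) (M ∘ fs) | cliques-≥0 k (tailAdj A) (λ v → M (fs v) ∧ link₀ A v) =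
  rearrange (cliques k (tailAdj A) (M ∘ fs) 2) (countFin k (M ∘ fs)) (cliques k (tailAdj A) (λ v → M (fs v) ∧ link₀ A v) 1)
  where
  rearrange : ∀ a b c → (a + b) + suc c ≡ (a + c) + (1 + b)
  rearrange = solve-∀
... | false rewrite cliques-≥1 k (tailAdj A) (M ∘ fs) = rearrange (cliques k (tailAdj A) (M ∘ fs) 2) (countFin k (M ∘ fs))
  where
  rearrange : ∀ a b → (a + b) + 0 ≡ (a + 0) + (0 + b)
  rearrange = solve-∀

countFin-everywhere : ∀ k → countFin k everywhere ≡ k
countFin-everywhere zero = refl
countFin-everywhere (suc k) = cong suc (countFin-everywhere k)

κ₀ : Graph → ℕ
κ₀ G = cliques (n G) (adj G) everywhere 0

κ₀≡κ : ∀ G → κ G + n G + 1 ≡ κ₀ G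
κ₀≡κ G rewrite κ≡cliques G | cliques-≥0 (n G) (adj G) everywhere | cliques-≥1 (n G) (adj G) everywhere
  | countFin-everywhere (n G) = +-comm _ 1

cliques-nowhere : ∀ k A → cliques k A (λ _ → false) 0 ≡ 1
cliques-nowhere zero A = refl
cliques-nowhere (suc k) A = trans (+-identityʳ _) (cliques-nowhere k (tailAdj A))

-- Disjoint union.  With masks on both sides, the cliques of A ⊕ B inside M₁ ⊕ M₂
-- are pairs of cliques, the empty set being counted once instead of twice.
adj⊕ : ∀ {p q} → (Fin p → Fin p → Bool) → (Fin q → Fin q → Bool) → Fin (p + q) → Fin (p + q) → Bool
adj⊕ {p} A B x y = ⊕adj A B (splitAt p x) (splitAt p y)

mask⊕ : ∀ {p q} → (Fin p → Bool) → (Fin q → Bool) → Fin (p + q) → Bool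
mask⊕ {p} M₁ M₂ x = [ M₁ , M₂ ]′ (splitAt p x)

⊕adj-tail : ∀ {p q} (A : Fin (suc p) → Fin (suc p) → Bool) (B : Fin q → Fin q → Bool) s t →
  ⊕adj A B (map₁ fs s) (map₁ fs t) ≡ ⊕adj (tailAdj A) B s t
⊕adj-tail A B (inj₁ x) (inj₁ y) = refl
⊕adj-tail A B (inj₁ x) (inj₂ y) = refl
⊕adj-tail A B (inj₂ x) (inj₁ y) = refl
⊕adj-tail A B (inj₂ x) (inj₂ y) = refl

mask-tail : ∀ {p q} (M₁ : Fin (suc p) → Bool) (M₂ : Fin q → Bool) s →
  [ M₁ , M₂ ]′ (map₁ fs s) ≡ [ M₁ ∘ fs , M₂ ]′ s
mask-tail M₁ M₂ (inj₁ x) = refl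
mask-tail M₁ M₂ (inj₂ y) = refl

mask-link : ∀ {p q} (A : Fin (suc p) → Fin (suc p) → Bool) (B : Fin q → Fin q → Bool)
  (M₁ : Fin (suc p) → Bool) (M₂ : Fin q → Bool) s →
  [ M₁ , M₂ ]′ (map₁ fs s) ∧ (⊕adj A B (inj₁ fz) (map₁ fs s) ∧ ⊕adj A B (map₁ fs s) (inj₁ fz))
  ≡ [ (λ v → M₁ (fs v) ∧ link₀ A v) , (λ _ → false) ]′ s
mask-link A B M₁ M₂ (inj₁ x) = refl
mask-link A B M₁ M₂ (inj₂ y) = ∧-zeroʳ (M₂ y)

cliques-⊕ : ∀ p q (A : Fin p → Fin p → Bool) (B : Fin q → Fin q → Bool) (M₁ : Fin p → Bool) (M₂ : Fin q → Bool) →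
  cliques (p + q) (adj⊕ A B) (mask⊕ M₁ M₂) 0 + 1 ≡ cliques p A M₁ 0 + cliques q B M₂ 0
cliques-⊕ zero q A B M₁ M₂ = +-comm _ 1
cliques-⊕ (suc p) q A B M₁ M₂ = goal
  where
  L : Fin p → Bool
  L = λ v → M₁ (fs v) ∧ link₀ A v
  T₁ : ℕ
  T₁ = cliques (p + q) (adj⊕ (tailAdj A) B) (mask⊕ (M₁ ∘ fs) M₂) 0
  T₂ : ℕ
  T₂ = cliques (p + q) (adj⊕ (tailAdj A) B) (mask⊕ L (λ _ → false)) 0
  avoid0 : cliques (p + q) (tailAdj (adj⊕ A B)) (mask⊕ M₁ M₂ ∘ fs) 0 ≡ T₁
  avoid0 = cliques-cong (p + q) 0 (λ i j → ⊕adj-tail A B (splitAt p i) (splitAt p j)) (λ i → mask-tail M₁ M₂ (splitAt p i))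
  through0 : cliques (p + q) (tailAdj (adj⊕ A B)) (λ v → mask⊕ M₁ M₂ (fs v) ∧ link₀ (adj⊕ A B) v) 0 ≡ T₂
  through0 = cliques-cong (p + q) 0 (λ i j → ⊕adj-tail A B (splitAt p i) (splitAt p j)) (λ i → mask-link A B M₁ M₂ (splitAt p i))
  ih₁ : T₁ + 1 ≡ cliques p (tailAdj A) (M₁ ∘ fs) 0 + cliques q B M₂ 0
  ih₁ = cliques-⊕ p q (tailAdj A) B (M₁ ∘ fs) M₂
  ih₂ : T₂ ≡ cliques p (tailAdj A) L 0
  ih₂ = +-cancelʳ-≡ 1 _ _ (trans (cliques-⊕ p q (tailAdj A) B L (λ _ → false)) (cong (cliques p (tailAdj A) L 0 +_) (cliques-nowhere q B)))
  goal : cliques (suc p + q) (adj⊕ A B) (mask⊕ M₁ M₂) 0 + 1 ≡ cliques (suc p) A M₁ 0 + cliques q B M₂ 0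
  goal rewrite avoid0 | through0 with M₁ fz
  ... | true rewrite sym ih₂ = trans (rearrange₁ T₁ T₂) (trans (cong (_+ T₂) ih₁)
        (rearrange₂ (cliques p (tailAdj A) (M₁ ∘ fs) 0) (cliques q B M₂ 0) T₂))
    where
    rearrange₁ : ∀ a b → (a + b) + 1 ≡ (a + 1) + b
    rearrange₁ = solve-∀
    rearrange₂ : ∀ a b c → (a + b) + c ≡ (a + c) + b
    rearrange₂ = solve-∀
  ... | false = trans (cong (_+ 1) (+-identityʳ T₁)) (trans ih₁ (cong (_+ cliques q B M₂ 0) (sym (+-identityʳ _))))

κ₀-⊕ : ∀ G H → κ₀ (G ⊕ H) + 1 ≡ κ₀ G + κ₀ H
κ₀-⊕ G H = trans (cong (_+ 1) (cliques-cong (n G + n H) 0 (λ i j → refl) (λ i → sym (mask-everywhere (splitAt (n G) i)))))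
  (cliques-⊕ (n G) (n H) (adj G) (adj H) everywhere everywhere)
  where
  mask-everywhere : ∀ (s : Fin (n G) ⊎ Fin (n H)) → [ everywhere , everywhere ]′ s ≡ true
  mask-everywhere (inj₁ x) = refl
  mask-everywhere (inj₂ y) = refl

κ-⊕ : ∀ G H → κ (G ⊕ H) ≡ κ G + κ H
κ-⊕ G H = +-cancelʳ-≡ (n G + n H + 1 + 1) _ _ (begin
    κ (G ⊕ H) + (n G + n H + 1 + 1)
  ≡⟨ rearrange₁ (κ (G ⊕ H)) (n G + n H) ⟩
    (κ (G ⊕ H) + (n G + n H) + 1) + 1
  ≡⟨ cong (_+ 1) (κ₀≡κ (G ⊕ H)) ⟩
    κ₀ (G ⊕ H) + 1
  ≡⟨ κ₀-⊕ G H ⟩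
    κ₀ G + κ₀ H
  ≡⟨ cong₂ _+_ (sym (κ₀≡κ G)) (sym (κ₀≡κ H)) ⟩
    (κ G + n G + 1) + (κ H + n H + 1)
  ≡⟨ rearrange₂ (κ G) (κ H) (n G) (n H) ⟩
    κ G + κ H + (n G + n H + 1 + 1) ∎)
  where
  open ≡-Reasoning
  rearrange₁ : ∀ a b → a + (b + 1 + 1) ≡ (a + b + 1) + 1
  rearrange₁ = solve-∀
  rearrange₂ : ∀ a b c d → (a + c + 1) + (b + d + 1) ≡ a + b + (c + d + 1 + 1)
  rearrange₂ = solve-∀

κ-copies : ∀ a H → κ (copies a H) ≡ a * κ H
κ-copies zero H = refl
κ-copies (suc a) H = trans (κ-⊕ H (copies a H)) (cong (κ H +_) (κ-copies a H))

-- 2. Staircase graphs: K_k and the colex graphs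

T-ext : ∀ {a b : Bool} → (T a → T b) → (T b → T a) → a ≡ b
T-ext {false} {false} _ _ = refl
T-ext {false} {true} _ g = ⊥-elim (g tt)
T-ext {true} {false} f _ = ⊥-elim (f tt)
T-ext {true} {true} _ _ = refl

T-true : ∀ {a} → T a → a ≡ true
T-true {true} _ = refl

T-false : ∀ {a} → ¬ T a → a ≡ false
T-false {false} _ = refl
T-false {true} h = ⊥-elim (h tt)

T∨₁ : ∀ {a} b → T a → T (a ∨ b)
T∨₁ {true} b _ = tt

T∨₂ : ∀ a {b} → T b → T (a ∨ b)
T∨₂ true _ = tt
T∨₂ false t = t

T∨-elim : ∀ a {b} → T (a ∨ b) → T a ⊎ T b
T∨-elim true _ = inj₁ tt
T∨-elim false t = inj₂ t

T∧ : ∀ {a b} → T a → T b → T (a ∧ b)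
T∧ {true} _ t = t

T∧₁ : ∀ a {b} → T (a ∧ b) → T a
T∧₁ true _ = tt

T∧₂ : ∀ a {b} → T (a ∧ b) → T b
T∧₂ true t = t

<ᵇ-irrefl : ∀ n → (n <ᵇ n) ≡ false
<ᵇ-irrefl zero = refl
<ᵇ-irrefl (suc n) = <ᵇ-irrefl n

<ᵇ-true : ∀ {m n} → m < n → (m <ᵇ n) ≡ true
<ᵇ-true p = T-true (<⇒<ᵇ p)

<ᵇ-false : ∀ {m n} → ¬ m < n → (m <ᵇ n) ≡ false
<ᵇ-false {m} {n} p = T-false (λ t → p (<ᵇ⇒< m n t))

<ᵇ-suc : ∀ v c → ((v <ᵇ c) ∨ (v ≡ᵇ c)) ≡ (v <ᵇ suc c)
<ᵇ-suc zero zero = refl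
<ᵇ-suc zero (suc c) = refl
<ᵇ-suc (suc v) zero = ∨-identityʳ (suc v <ᵇ 0)
<ᵇ-suc (suc v) (suc c) = <ᵇ-suc v c

-- It is a clique on {0,…,c−1} plus the vertex c joined to
-- {0,…,d−1}; `colexBelow c d i j` says that {i<j} precedes the (c, d) position.
colexBelow : ℕ → ℕ → ℕ → ℕ → Bool
colexBelow c d i j = (j <ᵇ c) ∨ ((j ≡ᵇ c) ∧ (i <ᵇ d))

stair : ℕ → ℕ → ℕ → ℕ → Bool
stair c d i j = ((i <ᵇ j) ∧ colexBelow c d i j) ∨ ((j <ᵇ i) ∧ colexBelow c d j i)

stairAdj : ∀ {k} → ℕ → ℕ → Fin k → Fin k → Bool
stairAdj c d i j = stair c d (toℕ i) (toℕ j)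

prefix : ∀ {k} → ℕ → Fin k → Bool
prefix p i = toℕ i <ᵇ p

stair-tail : ∀ c d i j → stair (suc c) d (suc i) (suc j) ≡ stair c (d ∸ 1) i j
stair-tail c d i j = cong₂ (λ a b → ((i <ᵇ j) ∧ a) ∨ ((j <ᵇ i) ∧ b)) (below-tail d i j) (below-tail d j i)
  where
  below-tail : ∀ d i j → colexBelow (suc c) d (suc i) (suc j) ≡ colexBelow c (d ∸ 1) i j
  below-tail zero i j = refl
  below-tail (suc d) i j = refl

linkSize : ℕ → ℕ → ℕ
linkSize c zero = c
linkSize c (suc d) = suc c

linkSize≥ : ∀ c d → c ≤ linkSize c d
linkSize≥ c zero = ≤-refl
linkSize≥ c (suc d) = n≤1+n c

link-stair : ∀ {n} c d (v : Fin n) → link₀ (stairAdj {suc n} (suc c) d) v ≡ (toℕ v <ᵇ linkSize c d)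
link-stair c zero v = simplify (toℕ v <ᵇ c) (toℕ v ≡ᵇ c)
  where
  simplify : ∀ a b → ((true ∧ (a ∨ (b ∧ false))) ∨ false) ∧ (a ∨ (b ∧ false)) ≡ a
  simplify true b = refl
  simplify false true = refl
  simplify false false = refl
link-stair c (suc d) v = trans (simplify (toℕ v <ᵇ c) (toℕ v ≡ᵇ c)) (<ᵇ-suc (toℕ v) c)
  where
  simplify : ∀ a b → ((true ∧ (a ∨ (b ∧ true))) ∨ false) ∧ (a ∨ (b ∧ true)) ≡ a ∨ b
  simplify true b = refl
  simplify false true = refl
  simplify false false = refl

prefix-∧ˡ : ∀ v p L → L ≤ p → ((v <ᵇ p) ∧ (v <ᵇ L)) ≡ (v <ᵇ L)
prefix-∧ˡ v p L le = T-ext (λ t → T∧₂ (v <ᵇ p) t) (λ t → T∧ (<⇒<ᵇ (<-≤-trans (<ᵇ⇒< v L t) le)) t)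

prefix-∧ʳ : ∀ v p L → p ≤ L → ((v <ᵇ p) ∧ (v <ᵇ L)) ≡ (v <ᵇ p)
prefix-∧ʳ v p L le = T-ext (λ t → T∧₁ (v <ᵇ p) t) (λ t → T∧ t (<⇒<ᵇ (<-≤-trans (<ᵇ⇒< v p t) le)))

stairCliques : ℕ → ℕ → ℕ → ℕ → ℕ
stairCliques n c d p = cliques n (stairAdj c d) (prefix p) 0

stairCliques-suc : ∀ n c d p L → (∀ (v : Fin n) → ((toℕ v <ᵇ p) ∧ (toℕ v <ᵇ linkSize c d)) ≡ (toℕ v <ᵇ L)) →
  stairCliques (suc n) (suc c) d (suc p) ≡ stairCliques n c (d ∸ 1) p + stairCliques n c (d ∸ 1) L
stairCliques-suc n c d p L link≡ = cong₂ _+_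
  (cliques-cong n 0 (λ i j → stair-tail c d (toℕ i) (toℕ j)) (λ _ → refl))
  (cliques-cong n 0 (λ i j → stair-tail c d (toℕ i) (toℕ j)) (λ v → trans (cong ((toℕ v <ᵇ p) ∧_) (link-stair c d v)) (link≡ v)))

stairCliques-clique : ∀ n c d p → p ≤ n → p ≤ c → stairCliques n c d p ≡ 2 ^ p
stairCliques-clique zero c d zero _ _ = refl
stairCliques-clique (suc n) c d zero _ _ = cliques-nowhere (suc n) (stairAdj c d)
stairCliques-clique (suc n) (suc c) d (suc p) (s≤s p≤n) (s≤s p≤c) = begin
    stairCliques (suc n) (suc c) d (suc p)
  ≡⟨ stairCliques-suc n c d p p (λ v → prefix-∧ʳ (toℕ v) p (linkSize c d) (≤-trans p≤c (linkSize≥ c d))) ⟩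
    stairCliques n c (d ∸ 1) p + stairCliques n c (d ∸ 1) p
  ≡⟨ cong₂ _+_ ih ih ⟩
    2 ^ p + 2 ^ p
  ≡⟨ cong (2 ^ p +_) (sym (+-identityʳ (2 ^ p))) ⟩
    2 ^ suc p ∎
  where
  open ≡-Reasoning
  ih : stairCliques n c (d ∸ 1) p ≡ 2 ^ p
  ih = stairCliques-clique n c (d ∸ 1) p p≤n p≤c

stair-0-0-tail : ∀ i j → stair 0 0 (suc i) (suc j) ≡ false
stair-0-0-tail i j = cong₂ _∨_ (∧-zeroʳ (i <ᵇ j)) (∧-zeroʳ (j <ᵇ i))

cliques-edgeless : ∀ n p → p ≤ n → cliques n (λ _ _ → false) (prefix p) 0 ≡ suc p
cliques-edgeless n zero _ = cliques-nowhere n _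
cliques-edgeless (suc n) (suc p) (s≤s p≤n) = trans (cong₂ _+_ (cliques-edgeless n p p≤n)
  (trans (cliques-cong n 0 (λ i j → refl) (λ v → ∧-zeroʳ (toℕ v <ᵇ p))) (cliques-nowhere n _))) (+-comm (suc p) 1)

-- A prefix of length p > c contains the whole staircase and p − c − 1 isolated
-- vertices: 2^c + 2^d − c − 1 + p cliques.
stairCliques-full : ∀ n c d p → d ≤ c → p ≤ n → c < p → stairCliques n c d p + c + 1 ≡ 2 ^ c + 2 ^ d + p
stairCliques-full (suc n) zero zero (suc p) _ (s≤s p≤n) _ = begin
    stairCliques (suc n) 0 0 (suc p) + 0 + 1
  ≡⟨ cong (λ z → z + 0 + 1) (cong₂ _+_
       (trans (cliques-cong n 0 (λ i j → stair-0-0-tail (toℕ i) (toℕ j)) (λ _ → refl)) (cliques-edgeless n p p≤n))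
       (trans (cliques-cong n 0 (λ _ _ → refl) (λ v → ∧-zeroʳ (toℕ v <ᵇ p))) (cliques-nowhere n _))) ⟩
    (suc p + 1) + 0 + 1
  ≡⟨ rearrange p ⟩
    1 + 1 + suc p ∎
  where
  open ≡-Reasoning
  rearrange : ∀ p → (suc p + 1) + 0 + 1 ≡ 1 + 1 + suc p
  rearrange = solve-∀
stairCliques-full (suc n) (suc c) zero (suc p) _ (s≤s p≤n) (s≤s c<p) = begin
    stairCliques (suc n) (suc c) 0 (suc p) + suc c + 1
  ≡⟨ cong (λ z → z + suc c + 1) (stairCliques-suc n c 0 p c (λ v → prefix-∧ˡ (toℕ v) p c (<⇒≤ c<p))) ⟩
    (E + stairCliques n c 0 c) + suc c + 1
  ≡⟨ cong (λ z → (E + z) + suc c + 1) (stairCliques-clique n c 0 c (≤-trans (<⇒≤ c<p) p≤n) ≤-refl) ⟩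
    (E + 2 ^ c) + suc c + 1
  ≡⟨ shift E (2 ^ c) c ⟩
    (E + c + 1) + 2 ^ c + 1
  ≡⟨ cong (λ z → z + 2 ^ c + 1) (stairCliques-full n c 0 p z≤n p≤n c<p) ⟩
    2 ^ c + 1 + p + 2 ^ c + 1
  ≡⟨ collect (2 ^ c) p ⟩
    2 * 2 ^ c + 1 + suc p ∎
  where
  open ≡-Reasoning
  E : ℕ
  E = stairCliques n c 0 p
  shift : ∀ e x c → (e + x) + suc c + 1 ≡ (e + c + 1) + x + 1
  shift = solve-∀
  collect : ∀ x p → x + 1 + p + x + 1 ≡ 2 * x + 1 + suc p
  collect = solve-∀
stairCliques-full (suc n) (suc c) (suc d) (suc p) (s≤s d≤c) (s≤s p≤n) (s≤s c<p) = begin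
    stairCliques (suc n) (suc c) (suc d) (suc p) + suc c + 1
  ≡⟨ cong (λ z → z + suc c + 1) (stairCliques-suc n c (suc d) p (suc c) (λ v → prefix-∧ˡ (toℕ v) p (suc c) c<p)) ⟩
    (stairCliques n c d p + stairCliques n c d (suc c)) + suc c + 1
  ≡⟨ add (stairCliques n c d p) (stairCliques n c d (suc c)) c p (2 ^ c) (2 ^ d)
       (stairCliques-full n c d p d≤c p≤n c<p) (stairCliques-full n c d (suc c) d≤c (≤-trans c<p p≤n) (n<1+n c)) ⟩
    2 * 2 ^ c + 2 * 2 ^ d + suc p ∎
  where
  open ≡-Reasoning
  add : ∀ e₁ e₂ c p X Y → e₁ + c + 1 ≡ X + Y + p → e₂ + c + 1 ≡ X + Y + suc c →
    (e₁ + e₂) + suc c + 1 ≡ 2 * X + 2 * Y + suc p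
  add e₁ e₂ c p X Y h₁ h₂ = +-cancelʳ-≡ (c + 1) _ _
    (trans (split e₁ e₂ c) (trans (cong₂ (λ a b → a + b + 1) h₁ h₂) (merge X Y c p)))
    where
    split : ∀ e₁ e₂ c → (e₁ + e₂) + suc c + 1 + (c + 1) ≡ (e₁ + c + 1) + (e₂ + c + 1) + 1
    split = solve-∀
    merge : ∀ X Y c p → (X + Y + p) + (X + Y + suc c) + 1 ≡ 2 * X + 2 * Y + suc p + (c + 1)
    merge = solve-∀

tri : ℕ → ℕ
tri c = c C 2

tri-suc : ∀ c → tri (suc c) ≡ tri c + c
tri-suc c = trans (sym (nCk+nC[k+1]≡[n+1]C[k+1] c 1)) (trans (cong (_+ c C 2) (nC1≡n c)) (+-comm c (c C 2)))

tri-mono : ∀ {m n} → m ≤ n → tri m ≤ tri n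
tri-mono {zero} _ = z≤n
tri-mono {suc m} {suc n} (s≤s le) rewrite tri-suc m | tri-suc n = +-mono-≤ (tri-mono le) le

colexRank< : ∀ c d i j → d < c → i < j → (tri j + i <ᵇ tri c + d) ≡ colexBelow c d i j
colexRank< c d i j d<c i<j = T-ext fwd bwd
  where
  fwd : T (tri j + i <ᵇ tri c + d) → T (colexBelow c d i j)
  fwd t with <ᵇ⇒< _ _ t | <-cmp j c
  ... | h | tri< j<c _ _ = T∨₁ _ (<⇒<ᵇ j<c)
  ... | h | tri≈ _ refl _ = T∨₂ (j <ᵇ j) (T∧ (≡⇒≡ᵇ j j refl) (<⇒<ᵇ (+-cancelˡ-< (tri j) i d h)))
  ... | h | tri> _ _ c<j = ⊥-elim (<-irrefl refl (<-≤-trans h (begin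
        tri c + d ≤⟨ +-monoʳ-≤ (tri c) (<⇒≤ d<c) ⟩
        tri c + c ≡⟨ sym (tri-suc c) ⟩
        tri (suc c) ≤⟨ tri-mono c<j ⟩
        tri j ≤⟨ m≤m+n (tri j) i ⟩
        tri j + i ∎)))
    where open ≤-Reasoning
  bwd : T (colexBelow c d i j) → T (tri j + i <ᵇ tri c + d)
  bwd t with T∨-elim (j <ᵇ c) t
  ... | inj₁ j<c = <⇒<ᵇ (begin-strict
        tri j + i <⟨ +-monoʳ-< (tri j) i<j ⟩
        tri j + j ≡⟨ sym (tri-suc j) ⟩
        tri (suc j) ≤⟨ tri-mono (<ᵇ⇒< j c j<c) ⟩
        tri c ≤⟨ m≤m+n (tri c) d ⟩
        tri c + d ∎)
    where open ≤-Reasoning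
  ... | inj₂ t₂ with ≡ᵇ⇒≡ j c (T∧₁ (j ≡ᵇ c) t₂)
  ... | refl = <⇒<ᵇ (+-monoʳ-< (tri j) (<ᵇ⇒< i d (T∧₂ (j ≡ᵇ j) t₂)))

colexAdj≡stair : ∀ c d → d < c → ∀ i j → colexAdj (tri c + d) i j ≡ stair c d i j
colexAdj≡stair c d d<c i j with <-cmp i j
... | tri< i<j _ j≮i rewrite <ᵇ-true i<j | <ᵇ-false j≮i = trans (colexRank< c d i j d<c i<j) (sym (∨-identityʳ _))
... | tri≈ _ refl _ rewrite <ᵇ-irrefl i = refl
... | tri> i≮j _ j<i rewrite <ᵇ-false i≮j | <ᵇ-true j<i = colexRank< c d j i d<c j<i

Kadj≡stair : ∀ k (x y : Fin k) → not ⌊ x ≟ y ⌋ ≡ stair k 0 (toℕ x) (toℕ y)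
Kadj≡stair k x y with x ≟ y
... | yes refl rewrite <ᵇ-irrefl (toℕ x) = refl
... | no x≢y with <-cmp (toℕ x) (toℕ y)
...   | tri< lt _ _ = sym (T-true (T∨₁ _ (T∧ (<⇒<ᵇ lt) (T∨₁ _ (<⇒<ᵇ (toℕ<n y))))))
...   | tri≈ _ eq _ = ⊥-elim (x≢y (toℕ-injective eq))
...   | tri> _ _ gt = sym (T-true (T∨₂ ((toℕ x <ᵇ toℕ y) ∧ colexBelow k 0 (toℕ x) (toℕ y))
                                   (T∧ (<⇒<ᵇ gt) (T∨₁ _ (<⇒<ᵇ (toℕ<n x))))))

prefix-everything : ∀ {k} (i : Fin k) → everywhere i ≡ prefix k i
prefix-everything i = sym (<ᵇ-true (toℕ<n i))

κ-K : ∀ k → κ (K k) + k + 1 ≡ 2 ^ k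
κ-K k = trans (κ₀≡κ (K k)) (trans (cliques-cong k 0 (Kadj≡stair k) prefix-everything)
  (stairCliques-clique k k 0 k ≤-refl ≤-refl))

-- The staircase count applies once the colex graph has more than c vertices.
κ-colex-large : ∀ c d → d < c → c ≤ tri c + d → κ (Colex (tri c + d)) + c + 2 ≡ 2 ^ c + 2 ^ d
κ-colex-large c d d<c c≤b = +-cancelʳ-≡ (suc b) _ _ (trans (rearrange (κ (Colex b)) c b)
    (trans (cong (λ z → z + c + 1) (κ₀≡κ (Colex b)))
    (trans (cong (λ z → z + c + 1) (cliques-cong (suc b) 0 (λ i j → colexAdj≡stair c d d<c (toℕ i) (toℕ j)) prefix-everything))
    (stairCliques-full (suc b) c d (suc b) (<⇒≤ d<c) ≤-refl (s≤s c≤b)))))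
  where
  b : ℕ
  b = tri c + d
  rearrange : ∀ k c b → k + c + 2 + suc b ≡ k + suc b + 1 + c + 1
  rearrange = solve-∀

tri-large : ∀ m → 3 + m ≤ tri (3 + m)
tri-large m = begin
    1 + (2 + m) ≤⟨ +-monoˡ-≤ (2 + m) one ⟩
    tri (2 + m) + (2 + m) ≡⟨ sym (tri-suc (2 + m)) ⟩
    tri (3 + m) ∎
  where
  open ≤-Reasoning
  one : 1 ≤ tri (2 + m)
  one = ≤-trans (s≤s z≤n) (≤-trans (m≤n+m (1 + m) (tri (1 + m))) (≤-reflexive (sym (tri-suc (1 + m)))))

κ-colex : ∀ c d → d < c → κ (Colex (tri c + d)) + c + 2 ≡ 2 ^ c + 2 ^ d
κ-colex (suc zero) zero d<c = refl
κ-colex (suc zero) (suc d) (s≤s ())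
κ-colex (suc (suc zero)) zero d<c = refl
κ-colex (suc (suc zero)) (suc zero) d<c = refl
κ-colex (suc (suc zero)) (suc (suc d)) (s≤s (s≤s ()))
κ-colex (suc (suc (suc m))) d d<c = κ-colex-large (3 + m) d d<c (≤-trans (tri-large m) (m≤m+n _ d))

-- 3. Colex weights

rowDecomp : ∀ t → Σ ℕ λ s → Σ ℕ λ u → u < s × t ≡ tri s + u
rowDecomp zero = 1 , 0 , s≤s z≤n , refl
rowDecomp (suc t) with rowDecomp t
... | s , u , u<s , refl with suc u <? s
...   | yes lt = s , suc u , lt , sym (+-suc (tri s) u)
...   | no nlt = suc s , 0 , s≤s z≤n ,
          sym (trans (+-identityʳ _) (trans (tri-suc s) (trans (cong (tri s +_) (sym row-end)) (+-suc (tri s) u))))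
  where
  row-end : suc u ≡ s
  row-end = ≤-antisym u<s (≮⇒≥ nlt)

nextPos : ℕ × ℕ → ℕ × ℕ
nextPos (c , d) = if suc d <ᵇ c then (c , suc d) else (suc c , 0)

edgePos : ℕ → ℕ × ℕ
edgePos zero = (1 , 0)
edgePos (suc t) = nextPos (edgePos t)

edgePos-tri : ∀ s u → u < suc s → edgePos (tri (suc s) + u) ≡ (suc s , u)
edgePos-tri zero zero _ = refl
edgePos-tri (suc s) zero _ = begin
    edgePos (tri (suc (suc s)) + 0) ≡⟨ cong edgePos (trans (+-identityʳ _) (trans (tri-suc (suc s)) (+-suc (tri (suc s)) s))) ⟩
    edgePos (suc (tri (suc s) + s)) ≡⟨ cong nextPos (edgePos-tri s s ≤-refl) ⟩
    nextPos (suc s , s) ≡⟨ cong (λ b → if b then (suc s , suc s) else (suc (suc s) , 0)) (<ᵇ-irrefl s) ⟩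
    (suc (suc s) , 0) ∎
  where open ≡-Reasoning
edgePos-tri s (suc u) lt = begin
    edgePos (tri (suc s) + suc u) ≡⟨ cong edgePos (+-suc (tri (suc s)) u) ⟩
    nextPos (edgePos (tri (suc s) + u)) ≡⟨ cong nextPos (edgePos-tri s u (<-trans (n<1+n u) lt)) ⟩
    nextPos (suc s , u) ≡⟨ cong (λ b → if b then (suc s , suc u) else (suc (suc s) , 0)) (<ᵇ-true lt) ⟩
    (suc s , suc u) ∎
  where open ≡-Reasoning

-- Adding edge t (in column u) to C(t) creates 2^u new cliques.
weight : ℕ → ℕ
weight t = 2 ^ proj₂ (edgePos t)

weight-tri : ∀ s u → u < s → weight (tri s + u) ≡ 2 ^ u
weight-tri (suc s) u lt = cong (λ p → 2 ^ proj₂ p) (edgePos-tri s u lt)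

window : ℕ → ℕ → ℕ
window a zero = 0
window a (suc k) = weight a + window (suc a) k

-- ℱ x: total weight of the first x edges; it will be κ(C(x)).
ℱ : ℕ → ℕ
ℱ x = window 0 x

window-split : ∀ a j k → window a (j + k) ≡ window a j + window (a + j) k
window-split a zero k = cong (λ z → window z k) (sym (+-identityʳ a))
window-split a (suc j) k = trans (cong (weight a +_)
    (trans (window-split (suc a) j k) (cong (λ z → window (suc a) j + window z k) (sym (+-suc a j)))))
  (sym (+-assoc (weight a) _ _))

ℱ-split : ∀ x k → ℱ (x + k) ≡ ℱ x + window x k
ℱ-split x k = window-split 0 x k

ℱ-mono : ∀ {x y} → x ≤ y → ℱ x ≤ ℱ y
ℱ-mono {x} le with m≤n⇒∃[o]m+o≡n le
... | k , refl = ≤-trans (m≤m+n (ℱ x) (window x k)) (≤-reflexive (sym (ℱ-split x k)))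

-- A window inside row s starting at column u sums a geometric series.
window-row : ∀ s u k → u + k ≤ s → window (tri s + u) k + 2 ^ u ≡ 2 ^ (u + k)
window-row s u zero le = cong (2 ^_) (sym (+-identityʳ u))
window-row s u (suc k) le = begin
    (weight (tri s + u) + window (suc (tri s + u)) k) + 2 ^ u
      ≡⟨ cong₂ (λ a b → (a + b) + 2 ^ u) (weight-tri s u (≤-trans (s≤s (m≤m+n u k)) (≤-trans (≤-reflexive (sym (+-suc u k))) le)))
             (cong (λ z → window z k) (sym (+-suc (tri s) u))) ⟩
    (2 ^ u + window (tri s + suc u) k) + 2 ^ u
      ≡⟨ double (2 ^ u) (window (tri s + suc u) k) ⟩
    window (tri s + suc u) k + 2 ^ suc u
      ≡⟨ window-row s (suc u) k (≤-trans (≤-reflexive (sym (+-suc u k))) le) ⟩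
    2 ^ (suc u + k)
      ≡⟨ cong (2 ^_) (sym (+-suc u k)) ⟩
    2 ^ (u + suc k) ∎
  where
  open ≡-Reasoning
  double : ∀ x y → (x + y) + x ≡ y + 2 * x
  double = solve-∀

window-row₀ : ∀ s k → k ≤ s → window (tri s) k + 1 ≡ 2 ^ k
window-row₀ s k le = trans (cong (λ z → window z k + 1) (sym (+-identityʳ (tri s)))) (window-row s 0 k le)

ℱ-tri-suc : ∀ p → ℱ (tri (suc p)) ≡ ℱ (tri p) + window (tri p) p
ℱ-tri-suc p = trans (cong ℱ (tri-suc p)) (ℱ-split (tri p) p)

ℱ-tri : ∀ s → ℱ (tri s) + s + 1 ≡ 2 ^ s
ℱ-tri zero = refl
ℱ-tri (suc s) = begin
    ℱ (tri (suc s)) + suc s + 1 ≡⟨ cong (λ z → z + suc s + 1) (ℱ-tri-suc s) ⟩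
    (ℱ (tri s) + window (tri s) s) + suc s + 1 ≡⟨ regroup (ℱ (tri s)) (window (tri s) s) s ⟩
    (ℱ (tri s) + s + 1) + (window (tri s) s + 1) ≡⟨ cong₂ _+_ (ℱ-tri s) (window-row₀ s s ≤-refl) ⟩
    2 ^ s + 2 ^ s ≡⟨ cong (2 ^ s +_) (sym (+-identityʳ (2 ^ s))) ⟩
    2 ^ suc s ∎
  where
  open ≡-Reasoning
  regroup : ∀ a b s → (a + b) + suc s + 1 ≡ (a + s + 1) + (b + 1)
  regroup = solve-∀

ℱ-colex : ∀ c d → d < c → ℱ (tri c + d) + c + 2 ≡ 2 ^ c + 2 ^ d
ℱ-colex c d d<c = begin
    ℱ (tri c + d) + c + 2 ≡⟨ cong (λ z → z + c + 2) (ℱ-split (tri c) d) ⟩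
    (ℱ (tri c) + window (tri c) d) + c + 2 ≡⟨ regroup (ℱ (tri c)) (window (tri c) d) c ⟩
    (ℱ (tri c) + c + 1) + (window (tri c) d + 1) ≡⟨ cong₂ _+_ (ℱ-tri c) (window-row₀ c d (<⇒≤ d<c)) ⟩
    2 ^ c + 2 ^ d ∎
  where
  open ≡-Reasoning
  regroup : ∀ a b c → (a + b) + c + 2 ≡ (a + c + 1) + (b + 1)
  regroup = solve-∀

κ-K≡ℱ : ∀ R → κ (K R) ≡ ℱ (tri R)
κ-K≡ℱ R = +-cancelʳ-≡ R _ _ (+-cancelʳ-≡ 1 _ _ (trans (κ-K R) (sym (ℱ-tri R))))

κ-colex≡ℱ : ∀ b → κ (Colex b) ≡ ℱ b
κ-colex≡ℱ b with rowDecomp b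
... | c , d , d<c , refl = +-cancelʳ-≡ c _ _ (+-cancelʳ-≡ 2 _ _ (trans (κ-colex c d d<c) (sym (ℱ-colex c d d<c))))

κ-extremal : ∀ R a b → κ (copies a (K R) ⊕ Colex b) ≡ a * ℱ (tri R) + ℱ b
κ-extremal R a b = trans (κ-⊕ (copies a (K R)) (Colex b))
  (cong₂ _+_ (trans (κ-copies a (K R)) (cong (a *_) (κ-K≡ℱ R))) (κ-colex≡ℱ b))

-- 4. Lower bounds for windows; superadditivity of ℱ

-- (X − 1)(Y − 1) ≥ 0, strictly when X, Y ≥ 2.
sum≤1+product : ∀ X Y → 1 ≤ X → 1 ≤ Y → X + Y ≤ 1 + X * Y
sum≤1+product (suc a) (suc b) _ _ = ≤-trans (m≤m+n (suc a + suc b) (a * b)) (≤-reflexive (expand a b))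
  where
  expand : ∀ a b → suc a + suc b + a * b ≡ 1 + suc a * suc b
  expand = solve-∀

sum<1+product : ∀ X Y → 2 ≤ X → 2 ≤ Y → X + Y < 1 + X * Y
sum<1+product (suc (suc a)) (suc (suc b)) _ _ =
  ≤-trans (m≤m+n (suc (suc (suc a) + suc (suc b))) (a + b + a * b)) (≤-reflexive (expand a b))
  where
  expand : ∀ a b → suc (suc (suc a) + suc (suc b)) + (a + b + a * b) ≡ 1 + suc (suc a) * suc (suc b)
  expand = solve-∀
sum<1+product (suc X) (suc zero) _ (s≤s ())
sum<1+product (suc zero) (suc (suc Y)) (s≤s ()) _

pow-scale : ∀ t i j → (2 ^ t * (2 ^ i + 2 ^ j) ≡ 2 ^ (t + i) + 2 ^ (t + j))
                    × (2 ^ t * (1 + 2 ^ i * 2 ^ j) ≡ 2 ^ t + 2 ^ (t + (i + j)))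
pow-scale t i j =
  trans (*-distribˡ-+ (2 ^ t) _ _) (sym (cong₂ _+_ (^-distribˡ-+-* 2 t i) (^-distribˡ-+-* 2 t j))) ,
  trans (*-distribˡ-+ (2 ^ t) 1 _) (cong₂ _+_ (*-identityʳ _)
    (sym (trans (^-distribˡ-+-* 2 t (i + j)) (cong (2 ^ t *_) (^-distribˡ-+-* 2 i j)))))

pow-convex : ∀ t i j → 2 ^ (t + i) + 2 ^ (t + j) ≤ 2 ^ t + 2 ^ (t + (i + j))
pow-convex t i j = subst₂ _≤_ (proj₁ (pow-scale t i j)) (proj₂ (pow-scale t i j))
  (*-monoʳ-≤ (2 ^ t) (sum≤1+product _ _ (m^n>0 2 i) (m^n>0 2 j)))

pow-convex< : ∀ t i j → 1 ≤ i → 1 ≤ j → 2 ^ (t + i) + 2 ^ (t + j) < 2 ^ t + 2 ^ (t + (i + j))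
pow-convex< t i j 1≤i 1≤j = subst₂ _<_ (proj₁ (pow-scale t i j)) (proj₂ (pow-scale t i j))
  (*-monoʳ-< (2 ^ t) {{m^n≢0 2 t}} (sum<1+product _ _ (^-monoʳ-≤ 2 1≤i) (^-monoʳ-≤ 2 1≤j)))

window-cross : ∀ s u a t → u + a ≡ s → t ≤ suc s → window (tri s + u) (a + t) + 2 ^ u + 1 ≡ 2 ^ s + 2 ^ t
window-cross s u a t u+a≡s t≤s+1 = begin
    window (tri s + u) (a + t) + 2 ^ u + 1
  ≡⟨ cong (λ z → z + 2 ^ u + 1) (window-split (tri s + u) a t) ⟩
    (window (tri s + u) a + window (tri s + u + a) t) + 2 ^ u + 1
  ≡⟨ regroup (window (tri s + u) a) (window (tri s + u + a) t) (2 ^ u) ⟩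
    (window (tri s + u) a + 2 ^ u) + (window (tri s + u + a) t + 1)
  ≡⟨ cong₂ _+_ (trans (window-row s u a (≤-reflexive u+a≡s)) (cong (2 ^_) u+a≡s))
       (trans (cong (λ z → window z t + 1) (trans (+-assoc (tri s) u a) (trans (cong (tri s +_) u+a≡s) (sym (tri-suc s)))))
         (window-row₀ (suc s) t t≤s+1)) ⟩
    2 ^ s + 2 ^ t ∎
  where
  open ≡-Reasoning
  regroup : ∀ a b c → (a + b) + c + 1 ≡ (a + c) + (b + 1)
  regroup = solve-∀

crossing : ∀ s u q → u < s → q ≤ s → s < u + q →
  Σ ℕ λ a → Σ ℕ λ t → Σ ℕ λ j → (s ≡ t + j + a) × (u ≡ t + j) × (q ≡ a + t)
crossing s u q u<s q≤s s<u+q with m≤n⇒∃[o]m+o≡n (<⇒≤ u<s)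
... | a , refl with m≤n⇒∃[o]m+o≡n (<⇒≤ (+-cancelˡ-< u a q s<u+q))
... | t , refl with m≤n⇒∃[o]m+o≡n (+-cancelˡ-≤ a t u (≤-trans q≤s (≤-reflexive (+-comm u a))))
... | j , refl = a , t , j , refl , refl , refl

crossing-convex : ∀ a t j → 2 ^ (a + t) + 2 ^ (t + j) ≤ 2 ^ (t + j + a) + 2 ^ t
crossing-convex a t j = subst₂ _≤_ (cong (λ e → 2 ^ e + 2 ^ (t + j)) (+-comm t a))
  (trans (cong (λ e → 2 ^ t + 2 ^ e) (reassoc t j a)) (+-comm (2 ^ t) _)) (pow-convex t a j)
  where
  reassoc : ∀ t j a → t + (a + j) ≡ t + j + a
  reassoc = solve-∀

crossing-convex< : ∀ a t j → 1 ≤ a → 1 ≤ j → 2 ^ (a + t) + 2 ^ (t + j) < 2 ^ (t + j + a) + 2 ^ t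
crossing-convex< a t j 1≤a 1≤j = subst₂ _<_ (cong (λ e → 2 ^ e + 2 ^ (t + j)) (+-comm t a))
  (trans (cong (λ e → 2 ^ t + 2 ^ e) (reassoc t j a)) (+-comm (2 ^ t) _)) (pow-convex< t a j 1≤a 1≤j)
  where
  reassoc : ∀ t j a → t + (a + j) ≡ t + j + a
  reassoc = solve-∀

window-lower : ∀ s u q → u < s → q ≤ s → 2 ^ q ≤ window (tri s + u) q + 1
window-lower s u q u<s q≤s with u + q ≤? s
... | yes inside = +-cancelˡ-≤ (2 ^ u) _ _ (≤-trans (pow-convex 0 u q)
      (≤-reflexive (trans (cong (1 +_) (sym (window-row s u q inside))) (regroup (window (tri s + u) q) (2 ^ u)))))
  where
  regroup : ∀ a b → 1 + (a + b) ≡ b + (a + 1)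
  regroup = solve-∀
... | no leaves with crossing s u q u<s q≤s (≰⇒> leaves)
... | a , t , j , refl , refl , refl = +-cancelʳ-≤ (2 ^ (t + j)) _ _ (≤-trans (crossing-convex a t j)
      (≤-reflexive (trans (sym (window-cross (t + j + a) (t + j) a t refl t≤s+1)) (regroup W (2 ^ (t + j))))))
  where
  W : ℕ
  W = window (tri (t + j + a) + (t + j)) (a + t)
  t≤s+1 : t ≤ suc (t + j + a)
  t≤s+1 = ≤-trans (m≤m+n t j) (≤-trans (m≤m+n (t + j) a) (n≤1+n _))
  regroup : ∀ w x → w + x + 1 ≡ w + 1 + x
  regroup = solve-∀

window-lower< : ∀ s u q → 1 ≤ u → u < s → 1 ≤ q → q < s → 2 ^ q ≤ window (tri s + u) q
window-lower< s u q 1≤u u<s 1≤q q<s with u + q ≤? s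
... | yes inside = +-cancelˡ-≤ (2 ^ u) _ _ (≤-pred (≤-trans (pow-convex< 0 u q 1≤u 1≤q)
      (≤-reflexive (trans (cong (1 +_) (sym (window-row s u q inside))) (regroup (window (tri s + u) q) (2 ^ u))))))
  where
  regroup : ∀ a b → 1 + (a + b) ≡ suc (b + a)
  regroup = solve-∀
... | no leaves with crossing s u q u<s (<⇒≤ q<s) (≰⇒> leaves)
... | a , t , j , refl , refl , refl = +-cancelʳ-≤ (2 ^ (t + j)) _ _ (≤-pred (≤-trans (crossing-convex< a t j 1≤a 1≤j)
      (≤-reflexive (trans (sym (window-cross (t + j + a) (t + j) a t refl t≤s+1)) (regroup W (2 ^ (t + j)))))))
  where
  W : ℕ
  W = window (tri (t + j + a) + (t + j)) (a + t)
  t≤s+1 : t ≤ suc (t + j + a)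
  t≤s+1 = ≤-trans (m≤m+n t j) (≤-trans (m≤m+n (t + j) a) (n≤1+n _))
  regroup : ∀ w x → w + x + 1 ≡ suc (w + x)
  regroup = solve-∀
  1≤a : 1 ≤ a
  1≤a = n≢0⇒n>0 (λ a≡0 → <-irrefl (sym (trans (cong ((t + j) +_) a≡0) (+-identityʳ _))) u<s)
  1≤j : 1 ≤ j
  1≤j = n≢0⇒n>0 (λ j≡0 → <-irrefl (sym (trans (cong (λ z → t + z + a) j≡0) (trans (cong (_+ a) (+-identityʳ t)) (+-comm t a)))) q<s)

row-mono : ∀ p s u → u < s → tri p ≤ tri s + u → p ≤ s
row-mono p s u u<s h with p ≤? s
... | yes p≤s = p≤s
... | no p≰s = ⊥-elim (<-irrefl refl (<-≤-trans (+-monoʳ-< (tri s) u<s)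
                 (≤-trans (≤-reflexive (sym (tri-suc s))) (≤-trans (tri-mono (≰⇒> p≰s)) h))))

window-lower-after : ∀ p z q → tri p ≤ z → q ≤ p → 2 ^ q ≤ window z q + 1
window-lower-after p z q h q≤p with rowDecomp z
... | s , u , u<s , refl = window-lower s u q u<s (≤-trans q≤p (row-mono p s u u<s h))

-- Moving a final row segment of weight 2^q − 1 onto the end of z does not lose
-- weight, and gains when the window at z weighs at least 2^q.
absorb-window : ∀ A W z q → W + 1 ≡ 2 ^ q → 2 ^ q ≤ window z q + 1 → A + W + ℱ z ≤ A + ℱ (z + q)
absorb-window A W z q W≡ h = begin
    A + W + ℱ z ≡⟨ exchange A W (ℱ z) ⟩
    A + (ℱ z + W) ≤⟨ +-monoʳ-≤ A (+-monoʳ-≤ (ℱ z) (+-cancelʳ-≤ 1 W (window z q) (≤-trans (≤-reflexive W≡) h))) ⟩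
    A + (ℱ z + window z q) ≡⟨ cong (A +_) (sym (ℱ-split z q)) ⟩
    A + ℱ (z + q) ∎
  where
  open ≤-Reasoning
  exchange : ∀ a b c → a + b + c ≡ a + (c + b)
  exchange = solve-∀

absorb-window< : ∀ A W z q → W + 1 ≡ 2 ^ q → 2 ^ q ≤ window z q → A + W + ℱ z < A + ℱ (z + q)
absorb-window< A W z q W≡ h = begin-strict
    A + W + ℱ z ≡⟨ exchange A W (ℱ z) ⟩
    A + (ℱ z + W) <⟨ +-monoʳ-< A (+-monoʳ-< (ℱ z) (≤-trans (≤-reflexive (trans (+-comm 1 W) W≡)) h)) ⟩
    A + (ℱ z + window z q) ≡⟨ cong (A +_) (sym (ℱ-split z q)) ⟩
    A + ℱ (z + q) ∎
  where
  open ≤-Reasoning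
  exchange : ∀ a b c → a + b + c ≡ a + (c + b)
  exchange = solve-∀

ℱ-superadd-row : ∀ p q z → q ≤ p → tri p ≤ z → ℱ (tri p + q) + ℱ z ≤ ℱ (z + (tri p + q))
ℱ-superadd-row zero zero z _ _ = ≤-reflexive (cong ℱ (sym (+-identityʳ z)))
ℱ-superadd-row (suc p) q z q≤p tri≤z = begin
    ℱ (P + q) + ℱ z ≡⟨ cong (_+ ℱ z) (ℱ-split P q) ⟩
    ℱ P + window P q + ℱ z ≤⟨ absorb-window (ℱ P) (window P q) z q (window-row₀ (suc p) q q≤p) (window-lower-after (suc p) z q tri≤z q≤p) ⟩
    ℱ P + ℱ (z + q) ≡⟨ cong (λ t → ℱ t + ℱ (z + q)) (tri-suc p) ⟩
    ℱ (tri p + p) + ℱ (z + q) ≤⟨ ℱ-superadd-row p p (z + q) ≤-refl (≤-trans (tri-mono (n≤1+n p)) (≤-trans tri≤z (m≤m+n z q))) ⟩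
    ℱ (z + q + (tri p + p)) ≡⟨ cong ℱ (reassoc z q (tri p + p) P (sym (tri-suc p))) ⟩
    ℱ (z + (P + q)) ∎
  where
  open ≤-Reasoning
  P : ℕ
  P = tri (suc p)
  reassoc : ∀ z q a b → a ≡ b → z + q + a ≡ z + (b + q)
  reassoc z q a b refl = trans (+-assoc z q a) (cong (z +_) (+-comm q a))

ℱ-superadd-tri : ∀ p z → tri p ≤ z → ℱ (tri p) + ℱ z ≤ ℱ (z + tri p)
ℱ-superadd-tri p z h = subst (λ t → ℱ t + ℱ z ≤ ℱ (z + t)) (+-identityʳ (tri p)) (ℱ-superadd-row p 0 z z≤n h)

ℱ-superadd-ordered : ∀ x y → x ≤ y → ℱ x + ℱ y ≤ ℱ (x + y)
ℱ-superadd-ordered x y x≤y with rowDecomp x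
... | p , q , q<p , refl = ≤-trans (ℱ-superadd-row p q y (<⇒≤ q<p) (≤-trans (m≤m+n (tri p) q) x≤y))
                                   (≤-reflexive (cong ℱ (+-comm y (tri p + q))))

ℱ-superadditive : ∀ x y → ℱ x + ℱ y ≤ ℱ (x + y)
ℱ-superadditive x y with x ≤? y
... | yes x≤y = ℱ-superadd-ordered x y x≤y
... | no x≰y = ≤-trans (≤-reflexive (+-comm (ℱ x) (ℱ y)))
    (≤-trans (ℱ-superadd-ordered y x (<⇒≤ (≰⇒> x≰y))) (≤-reflexive (cong ℱ (+-comm y x))))

-- Write x = tri p + q and y = tri s + u (q < p ≤ s, u < s).
-- Moving the last (partial) rows of x onto the end of y gains weight as soon as one
-- of the moved segments lands strictly inside a row; the only exceptions are x = 0
-- and x = 1 with y = tri s.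
tri≤after : ∀ {p s} a b → p ≤ s → tri p ≤ tri s + a + b
tri≤after {p} {s} a b p≤s = ≤-trans (tri-mono p≤s) (≤-trans (m≤m+n (tri s) a) (m≤m+n _ b))

superadd<-partial-partial : ∀ p q s u → 1 ≤ q → q < p → 1 ≤ u → u < s → p ≤ s →
  ℱ (tri p + q) + ℱ (tri s + u) < ℱ (tri p + q + (tri s + u))
superadd<-partial-partial p q s u 1≤q q<p 1≤u u<s p≤s = begin-strict
    ℱ (tri p + q) + ℱ y ≡⟨ cong (_+ ℱ y) (ℱ-split (tri p) q) ⟩
    ℱ (tri p) + window (tri p) q + ℱ y
      <⟨ absorb-window< (ℱ (tri p)) (window (tri p) q) y q (window-row₀ p q (<⇒≤ q<p))
           (window-lower< s u q 1≤u u<s 1≤q (<-≤-trans q<p p≤s)) ⟩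
    ℱ (tri p) + ℱ (y + q) ≤⟨ ℱ-superadd-tri p (y + q) (tri≤after u q p≤s) ⟩
    ℱ (y + q + tri p) ≡⟨ cong ℱ (reorder y q (tri p)) ⟩
    ℱ (tri p + q + y) ∎
  where
  open ≤-Reasoning
  y : ℕ
  y = tri s + u
  reorder : ∀ y q T → y + q + T ≡ T + q + y
  reorder = solve-∀

superadd<-partial-full : ∀ p q s → 1 ≤ q → q < suc p → suc p ≤ s →
  ℱ (tri (suc p) + q) + ℱ (tri s) < ℱ (tri (suc p) + q + tri s)
superadd<-partial-full p q s 1≤q q<P P≤s = begin-strict
    ℱ (tri P + q) + ℱ y ≡⟨ cong (_+ ℱ y) (trans (ℱ-split (tri P) q) (cong (_+ window (tri P) q) (ℱ-tri-suc p))) ⟩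
    A + window (tri P) q + ℱ y
      ≤⟨ absorb-window A (window (tri P) q) y q (window-row₀ P q (<⇒≤ q<P)) (≤-reflexive (sym (window-row₀ s q q≤s))) ⟩
    ℱ (tri p) + window (tri p) p + ℱ (y + q)
      <⟨ absorb-window< (ℱ (tri p)) (window (tri p) p) (y + q) p (window-row₀ p p ≤-refl)
           (window-lower< s q p 1≤q (<-≤-trans q<P P≤s) (≤-trans 1≤q (≤-pred q<P)) P≤s) ⟩
    ℱ (tri p) + ℱ (y + q + p) ≤⟨ ℱ-superadd-tri p (y + q + p) (tri≤after q p (≤-trans (n≤1+n p) P≤s)) ⟩
    ℱ (y + q + p + tri p) ≡⟨ cong ℱ (trans (reorder y q p (tri p)) (cong (λ t → t + q + y) (sym (tri-suc p)))) ⟩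
    ℱ (tri P + q + y) ∎
  where
  open ≤-Reasoning
  P : ℕ
  P = suc p
  y : ℕ
  y = tri s
  A : ℕ
  A = ℱ (tri p) + window (tri p) p
  q≤s : q ≤ s
  q≤s = ≤-trans (<⇒≤ q<P) P≤s
  reorder : ∀ y q p T → y + q + p + T ≡ T + p + q + y
  reorder = solve-∀

superadd<-full-partial : ∀ p s u → 1 ≤ p → 1 ≤ u → u < s → suc p ≤ s →
  ℱ (tri (suc p)) + ℱ (tri s + u) < ℱ (tri (suc p) + (tri s + u))
superadd<-full-partial p s u 1≤p 1≤u u<s P≤s = begin-strict
    ℱ (tri P) + ℱ y ≡⟨ cong (_+ ℱ y) (ℱ-tri-suc p) ⟩
    ℱ (tri p) + window (tri p) p + ℱ y
      <⟨ absorb-window< (ℱ (tri p)) (window (tri p) p) y p (window-row₀ p p ≤-refl) (window-lower< s u p 1≤u u<s 1≤p P≤s) ⟩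
    ℱ (tri p) + ℱ (y + p) ≤⟨ ℱ-superadd-tri p (y + p) (tri≤after u p (≤-trans (n≤1+n p) P≤s)) ⟩
    ℱ (y + p + tri p) ≡⟨ cong ℱ (trans (reorder y p (tri p)) (cong (_+ y) (sym (tri-suc p)))) ⟩
    ℱ (tri P + y) ∎
  where
  open ≤-Reasoning
  P : ℕ
  P = suc p
  y : ℕ
  y = tri s + u
  reorder : ∀ y p T → y + p + T ≡ T + p + y
  reorder = solve-∀

superadd<-full-full : ∀ p s → 1 ≤ p → suc (suc p) ≤ s →
  ℱ (tri (suc (suc p))) + ℱ (tri s) < ℱ (tri (suc (suc p)) + tri s)
superadd<-full-full p s 1≤p P'≤s = begin-strict
    ℱ (tri P') + ℱ y ≡⟨ cong (_+ ℱ y) (trans (ℱ-tri-suc P) (cong (_+ window (tri P) P) (ℱ-tri-suc p))) ⟩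
    B + window (tri P) P + ℱ y
      ≤⟨ absorb-window B (window (tri P) P) y P (window-row₀ P P ≤-refl) (≤-reflexive (sym (window-row₀ s P P≤s))) ⟩
    ℱ (tri p) + window (tri p) p + ℱ (y + P)
      <⟨ absorb-window< (ℱ (tri p)) (window (tri p) p) (y + P) p (window-row₀ p p ≤-refl)
           (window-lower< s P p (s≤s z≤n) P'≤s 1≤p (<-trans (n<1+n p) P'≤s)) ⟩
    ℱ (tri p) + ℱ (y + P + p) ≤⟨ ℱ-superadd-tri p (y + P + p) (tri≤after P p (≤-trans (n≤1+n p) P≤s)) ⟩
    ℱ (y + P + p + tri p) ≡⟨ cong ℱ (trans (reorder y P p (tri p)) (cong (λ t → t + P + y) (sym (tri-suc p)))) ⟩
    ℱ (tri P + P + y) ≡⟨ cong (λ t → ℱ (t + y)) (sym (tri-suc P)) ⟩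
    ℱ (tri P' + y) ∎
  where
  open ≤-Reasoning
  P : ℕ
  P = suc p
  P' : ℕ
  P' = suc P
  y : ℕ
  y = tri s
  B : ℕ
  B = ℱ (tri p) + window (tri p) p
  P≤s : P ≤ s
  P≤s = ≤-trans (n≤1+n P) P'≤s
  reorder : ∀ y P p T → y + P + p + T ≡ T + p + P + y
  reorder = solve-∀

SuperaddCase : ℕ → ℕ → Set
SuperaddCase x y = (ℱ x + ℱ y < ℱ (x + y)) ⊎ ((x ≡ 0) ⊎ (x ≡ 1 × Σ ℕ λ c → 2 ≤ c × y ≡ tri c))

superadd-rows : ∀ p q s u → q < p → u < s → p ≤ s → SuperaddCase (tri p + q) (tri s + u)
superadd-rows 1 zero s u _ _ _ = inj₂ (inj₁ refl)
superadd-rows 1 (suc q) s u (s≤s ()) _ _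
superadd-rows (suc (suc p)) (suc q) s (suc u) q<p u<s p≤s =
  inj₁ (superadd<-partial-partial (suc (suc p)) (suc q) s (suc u) (s≤s z≤n) q<p (s≤s z≤n) u<s p≤s)
superadd-rows (suc (suc p)) (suc q) s zero q<p u<s p≤s =
  inj₁ (subst (λ y → ℱ (tri (2 + p) + suc q) + ℱ y < ℱ (tri (2 + p) + suc q + y)) (sym (+-identityʳ (tri s)))
         (superadd<-partial-full (suc p) (suc q) s (s≤s z≤n) q<p p≤s))
superadd-rows (suc (suc p)) zero s (suc u) q<p u<s p≤s =
  inj₁ (subst (λ x → ℱ x + ℱ (tri s + suc u) < ℱ (x + (tri s + suc u))) (sym (+-identityʳ (tri (2 + p))))
         (superadd<-full-partial (suc p) s (suc u) (s≤s z≤n) (s≤s z≤n) u<s p≤s))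
superadd-rows 2 zero s zero _ _ p≤s = inj₂ (inj₂ (refl , s , p≤s , +-identityʳ (tri s)))
superadd-rows (suc (suc (suc p))) zero s zero q<p u<s p≤s =
  inj₁ (subst₂ (λ x y → ℱ x + ℱ y < ℱ (x + y)) (sym (+-identityʳ (tri (3 + p)))) (sym (+-identityʳ (tri s)))
         (superadd<-full-full (suc p) s (s≤s z≤n) p≤s))

ℱ-superadd-cases : ∀ x y → x ≤ y → SuperaddCase x y
ℱ-superadd-cases x y x≤y with rowDecomp x | rowDecomp y
... | p , q , q<p , refl | s , u , u<s , refl =
  superadd-rows p q s u q<p u<s (row-mono p s u u<s (≤-trans (m≤m+n (tri p) q) x≤y))

-- 5. Upper bounds for windows; the carry is profitable

window-upper-row : ∀ R v k i → v + k ≤ R → v + (k + i) ≡ R → window (tri R + v) k + 2 ^ (v + i) ≤ 2 ^ R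
window-upper-row R v k i v+k≤R row≡ = +-cancelʳ-≤ (2 ^ v) _ _ (begin
    window (tri R + v) k + 2 ^ (v + i) + 2 ^ v ≡⟨ exchange (window (tri R + v) k) (2 ^ (v + i)) (2 ^ v) ⟩
    (window (tri R + v) k + 2 ^ v) + 2 ^ (v + i) ≡⟨ cong (_+ 2 ^ (v + i)) (window-row R v k v+k≤R) ⟩
    2 ^ (v + k) + 2 ^ (v + i) ≤⟨ pow-convex v k i ⟩
    2 ^ v + 2 ^ (v + (k + i)) ≡⟨ cong (λ t → 2 ^ v + 2 ^ t) row≡ ⟩
    2 ^ v + 2 ^ R ≡⟨ +-comm (2 ^ v) _ ⟩
    2 ^ R + 2 ^ v ∎)
  where
  open ≤-Reasoning
  exchange : ∀ a b c → a + b + c ≡ (a + c) + b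
  exchange = solve-∀

window-upper-row< : ∀ R v k i → 1 ≤ k → 1 ≤ i → v + k ≤ R → v + (k + i) ≡ R → window (tri R + v) k + 2 ^ (v + i) < 2 ^ R
window-upper-row< R v k i 1≤k 1≤i v+k≤R row≡ = +-cancelʳ-< (2 ^ v) _ _ (begin-strict
    window (tri R + v) k + 2 ^ (v + i) + 2 ^ v ≡⟨ exchange (window (tri R + v) k) (2 ^ (v + i)) (2 ^ v) ⟩
    (window (tri R + v) k + 2 ^ v) + 2 ^ (v + i) ≡⟨ cong (_+ 2 ^ (v + i)) (window-row R v k v+k≤R) ⟩
    2 ^ (v + k) + 2 ^ (v + i) <⟨ pow-convex< v k i 1≤k 1≤i ⟩
    2 ^ v + 2 ^ (v + (k + i)) ≡⟨ cong (λ t → 2 ^ v + 2 ^ t) row≡ ⟩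
    2 ^ v + 2 ^ R ≡⟨ +-comm (2 ^ v) _ ⟩
    2 ^ R + 2 ^ v ∎)
  where
  open ≤-Reasoning
  exchange : ∀ a b c → a + b + c ≡ (a + c) + b
  exchange = solve-∀

add-halves : ∀ W P Q → W + P ≤ Q → P ≤ Q → W + 2 * P ≤ 2 * Q
add-halves W P Q h₁ h₂ = ≤-trans (≤-reflexive (split W P)) (≤-trans (+-mono-≤ h₁ h₂) (≤-reflexive (double Q)))
  where
  split : ∀ w p → w + 2 * p ≡ (w + p) + p
  split = solve-∀
  double : ∀ p → p + p ≡ 2 * p
  double = solve-∀

add-halves< : ∀ W P Q → W + P ≤ Q → P < Q → W + 2 * P < 2 * Q
add-halves< W P Q h₁ h₂ = ≤-trans (≤-reflexive (cong suc (split W P))) (≤-trans (+-mono-≤-< h₁ h₂) (≤-reflexive (double Q)))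
  where
  split : ∀ w p → w + 2 * p ≡ (w + p) + p
  split = solve-∀
  double : ∀ p → p + p ≡ 2 * p
  double = solve-∀

add-first-rest : ∀ w W P Q → w + 0 + P ≤ Q → W + 1 ≤ Q → w + W + 1 + P ≤ 2 * Q
add-first-rest w W P Q h₁ h₂ = ≤-trans (≤-reflexive (regroup w W P)) (≤-trans (+-mono-≤ h₁ h₂) (≤-reflexive (double Q)))
  where
  regroup : ∀ a b c → a + b + 1 + c ≡ (a + 0 + c) + (b + 1)
  regroup = solve-∀
  double : ∀ p → p + p ≡ 2 * p
  double = solve-∀

add-crossing : ∀ A B P₂ Pj Pa Q → A + Pa ≤ Q → B + 1 ≡ P₂ → P₂ + Pj ≤ 1 + 2 * Pa → Pa ≤ Q → A + B + Pj ≤ 2 * Q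
add-crossing A B P₂ Pj Pa Q h₁ h₂ h₃ h₄ = +-cancelʳ-≤ 1 _ _ (begin
    A + B + Pj + 1 ≡⟨ regroup₁ A B Pj ⟩
    A + (B + 1) + Pj ≡⟨ cong (λ t → A + t + Pj) h₂ ⟩
    A + P₂ + Pj ≡⟨ +-assoc A P₂ Pj ⟩
    A + (P₂ + Pj) ≤⟨ +-monoʳ-≤ A h₃ ⟩
    A + (1 + 2 * Pa) ≡⟨ regroup₂ A Pa ⟩
    (A + Pa) + Pa + 1 ≤⟨ +-monoˡ-≤ 1 (+-mono-≤ h₁ h₄) ⟩
    Q + Q + 1 ≡⟨ regroup₃ Q ⟩
    2 * Q + 1 ∎)
  where
  open ≤-Reasoning
  regroup₁ : ∀ a b c → a + b + c + 1 ≡ a + (b + 1) + c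
  regroup₁ = solve-∀
  regroup₂ : ∀ a p → a + (1 + 2 * p) ≡ (a + p) + p + 1
  regroup₂ = solve-∀
  regroup₃ : ∀ p → p + p + 1 ≡ 2 * p + 1
  regroup₃ = solve-∀

add-crossing< : ∀ A B P₂ Pj Pa Q → A + Pa ≤ Q → B + 1 ≡ P₂ → P₂ + Pj ≤ 1 + 2 * Pa → Pa < Q → A + B + Pj < 2 * Q
add-crossing< A B P₂ Pj Pa Q h₁ h₂ h₃ h₄ = +-cancelʳ-< 1 _ _ (begin-strict
    A + B + Pj + 1 ≡⟨ regroup₁ A B Pj ⟩
    A + (B + 1) + Pj ≡⟨ cong (λ t → A + t + Pj) h₂ ⟩
    A + P₂ + Pj ≡⟨ +-assoc A P₂ Pj ⟩
    A + (P₂ + Pj) ≤⟨ +-monoʳ-≤ A h₃ ⟩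
    A + (1 + 2 * Pa) ≡⟨ regroup₂ A Pa ⟩
    (A + Pa) + Pa + 1 <⟨ +-monoˡ-< 1 (+-mono-≤-< h₁ h₄) ⟩
    Q + Q + 1 ≡⟨ regroup₃ Q ⟩
    2 * Q + 1 ∎)
  where
  open ≤-Reasoning
  regroup₁ : ∀ a b c → a + b + c + 1 ≡ a + (b + 1) + c
  regroup₁ = solve-∀
  regroup₂ : ∀ a p → a + (1 + 2 * p) ≡ (a + p) + p + 1
  regroup₂ = solve-∀
  regroup₃ : ∀ p → p + p + 1 ≡ 2 * p + 1
  regroup₃ = solve-∀

WindowBound : ℕ → Set
WindowBound R = ∀ z k j → k + j ≡ R → z + k ≤ tri (suc R) → window z k + 2 ^ j ≤ 2 ^ R

in-last-row : ∀ R z k → tri (suc R) + z + k ≤ tri (suc (suc R)) → z + k ≤ suc R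
in-last-row R z k h = +-cancelˡ-≤ (tri (suc R)) _ _
  (≤-trans (≤-reflexive (sym (+-assoc (tri (suc R)) z k))) (≤-trans h (≤-reflexive (tri-suc (suc R)))))

in-last-row< : ∀ R z k → tri (suc R) + z + k < tri (suc (suc R)) → z + k < suc R
in-last-row< R z k h = +-cancelˡ-< (tri (suc R)) _ _
  (≤-trans (≤-reflexive (cong suc (sym (+-assoc (tri (suc R)) z k)))) (≤-trans h (≤-reflexive (tri-suc (suc R)))))

window-upper-before : ∀ R → WindowBound R → ∀ z k j → k + j ≡ suc R → z + k ≤ tri (suc R) → window z k + 2 ^ j ≤ 2 ^ suc R
window-upper-before R IH z k (suc j) k+j≡ before = add-halves (window z k) (2 ^ j) (2 ^ R) (IH z k j k+j≡R before)
  (^-monoʳ-≤ 2 (≤-trans (m≤n+m j k) (≤-reflexive k+j≡R)))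
  where
  k+j≡R : k + j ≡ R
  k+j≡R = suc-injective (trans (sym (+-suc k j)) k+j≡)
window-upper-before zero IH z k zero k+j≡ before =
  ⊥-elim (0≢1+n (trans (sym (m+n≡0⇒n≡0 z (n≤0⇒n≡0 before))) (trans (sym (+-identityʳ k)) k+j≡)))
window-upper-before (suc R) IH z k zero k+j≡ before with trans (sym (+-identityʳ k)) k+j≡
... | refl = ≤-trans (m≤m+n (weight z + window (suc z) (suc R) + 1) (2 ^ R))
      (add-first-rest (weight z) (window (suc z) (suc R)) (2 ^ R) (2 ^ suc R)
        (IH z 1 R refl (≤-trans (+-monoʳ-≤ z (s≤s z≤n)) before))
        (IH (suc z) (suc R) 0 (+-identityʳ _) (≤-trans (≤-reflexive (sym (+-suc z (suc R)))) before)))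

window-upper-crossing : ∀ R → WindowBound R → ∀ z k j → k + j ≡ suc R → z < tri (suc R) → tri (suc R) < z + k →
  window z k + 2 ^ j ≤ 2 ^ suc R
window-upper-crossing R IH z k j k+j≡ z< <z+k with m≤n⇒∃[o]m+o≡n (<⇒≤ z<)
... | j₁ , z+j₁≡ with m≤n⇒∃[o]m+o≡n (<⇒≤ (+-cancelˡ-< z j₁ k (≤-trans (≤-reflexive (cong suc z+j₁≡)) <z+k)))
... | j₂ , refl with m≤n⇒∃[o]m+o≡n (+-cancelʳ-≤ 1 j₁ R (≤-trans (+-monoʳ-≤ j₁ (n≢0⇒n>0 j₂≢0))
                       (≤-trans (m≤m+n (j₁ + j₂) j) (≤-reflexive (trans k+j≡ (+-comm 1 R))))))
  where
  j₂≢0 : ¬ (j₂ ≡ 0)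
  j₂≢0 refl = <-irrefl (trans (sym z+j₁≡) (cong (z +_) (sym (+-identityʳ j₁)))) <z+k
... | a , refl = ≤-trans (≤-reflexive (cong (_+ 2 ^ j) (trans (window-split z j₁ j₂) (cong (λ t → window z j₁ + window t j₂) z+j₁≡))))
      (add-crossing (window z j₁) (window N j₂) (2 ^ j₂) (2 ^ j) (2 ^ a) (2 ^ (j₁ + a))
        (IH z j₁ a refl (≤-reflexive z+j₁≡))
        (window-row₀ (suc (j₁ + a)) j₂ (≤-trans (m≤m+n j₂ j) (≤-trans (≤-reflexive j₂+j≡) (s≤s (m≤n+m a j₁)))))
        (≤-trans (pow-convex 0 j₂ j) (≤-reflexive (cong (λ t → 1 + 2 ^ t) j₂+j≡)))
        (^-monoʳ-≤ 2 (m≤n+m a j₁)))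
  where
  N : ℕ
  N = tri (suc (j₁ + a))
  j₂+j≡ : j₂ + j ≡ suc a
  j₂+j≡ = +-cancelˡ-≡ j₁ _ _ (trans (sym (+-assoc j₁ j₂ j)) (trans k+j≡ (sym (+-suc j₁ a))))

window-upper : ∀ R → WindowBound R
window-upper zero z zero zero refl h = ≤-refl
window-upper (suc R) z k j k+j≡ h with tri (suc R) ≤? z
... | yes last with m≤n⇒∃[o]m+o≡n last
...   | v , refl with m≤n⇒∃[o]m+o≡n (+-cancelʳ-≤ k v j (≤-trans (in-last-row R v k h) (≤-reflexive (trans (sym k+j≡) (+-comm k j)))))
...   | i , refl = window-upper-row (suc R) v k i (in-last-row R v k h) (trans (reorder v k i) k+j≡)
  where
  reorder : ∀ v k i → v + (k + i) ≡ k + (v + i)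
  reorder = solve-∀
window-upper (suc R) z k j k+j≡ h | no not-last with z + k ≤? tri (suc R)
... | yes before = window-upper-before R (window-upper R) z k j k+j≡ before
... | no crossing = window-upper-crossing R (window-upper R) z k j k+j≡ (≰⇒> not-last) (≰⇒> crossing)

window-upper-before< : ∀ R z k j → 1 ≤ k → k + j ≡ suc R → z + k ≤ tri (suc R) → window z k + 2 ^ j < 2 ^ suc R
window-upper-before< R z k (suc j) 1≤k k+j≡ before = add-halves< (window z k) (2 ^ j) (2 ^ R) (window-upper R z k j k+j≡R before)
  (^-monoʳ-< 2 (s≤s (s≤s z≤n)) (≤-trans (+-monoˡ-≤ j 1≤k) (≤-reflexive k+j≡R)))
  where
  k+j≡R : k + j ≡ R
  k+j≡R = suc-injective (trans (sym (+-suc k j)) k+j≡)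
window-upper-before< zero z k zero 1≤k k+j≡ before =
  ⊥-elim (0≢1+n (trans (sym (m+n≡0⇒n≡0 z (n≤0⇒n≡0 before))) (trans (sym (+-identityʳ k)) k+j≡)))
window-upper-before< (suc R) z k zero 1≤k k+j≡ before with trans (sym (+-identityʳ k)) k+j≡
... | refl = ≤-trans (≤-trans (≤-reflexive (+-comm 1 _)) (+-monoʳ-≤ (weight z + window (suc z) (suc R) + 1) (m^n>0 2 R)))
      (add-first-rest (weight z) (window (suc z) (suc R)) (2 ^ R) (2 ^ suc R)
        (window-upper (suc R) z 1 R refl (≤-trans (+-monoʳ-≤ z (s≤s z≤n)) before))
        (window-upper (suc R) (suc z) (suc R) 0 (+-identityʳ _) (≤-trans (≤-reflexive (sym (+-suc z (suc R)))) before)))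

window-upper-crossing< : ∀ R z k j → k + j ≡ suc R → z < tri (suc R) → tri (suc R) < z + k → window z k + 2 ^ j < 2 ^ suc R
window-upper-crossing< R z k j k+j≡ z< <z+k with m≤n⇒∃[o]m+o≡n (<⇒≤ z<)
... | j₁ , z+j₁≡ with m≤n⇒∃[o]m+o≡n (<⇒≤ (+-cancelˡ-< z j₁ k (≤-trans (≤-reflexive (cong suc z+j₁≡)) <z+k)))
... | j₂ , refl with m≤n⇒∃[o]m+o≡n (+-cancelʳ-≤ 1 j₁ R (≤-trans (+-monoʳ-≤ j₁ (n≢0⇒n>0 j₂≢0))
                       (≤-trans (m≤m+n (j₁ + j₂) j) (≤-reflexive (trans k+j≡ (+-comm 1 R))))))
  where
  j₂≢0 : ¬ (j₂ ≡ 0)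
  j₂≢0 refl = <-irrefl (trans (sym z+j₁≡) (cong (z +_) (sym (+-identityʳ j₁)))) <z+k
... | a , refl = ≤-trans (≤-reflexive (cong (λ t → suc (t + 2 ^ j)) (trans (window-split z j₁ j₂) (cong (λ t → window z j₁ + window t j₂) z+j₁≡))))
      (add-crossing< (window z j₁) (window N j₂) (2 ^ j₂) (2 ^ j) (2 ^ a) (2 ^ (j₁ + a))
        (window-upper (j₁ + a) z j₁ a refl (≤-reflexive z+j₁≡))
        (window-row₀ (suc (j₁ + a)) j₂ (≤-trans (m≤m+n j₂ j) (≤-trans (≤-reflexive j₂+j≡) (s≤s (m≤n+m a j₁)))))
        (≤-trans (pow-convex 0 j₂ j) (≤-reflexive (cong (λ t → 1 + 2 ^ t) j₂+j≡)))
        (^-monoʳ-< 2 (s≤s (s≤s z≤n)) (+-monoˡ-≤ a (n≢0⇒n>0 j₁≢0))))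
  where
  N : ℕ
  N = tri (suc (j₁ + a))
  j₂+j≡ : j₂ + j ≡ suc a
  j₂+j≡ = +-cancelˡ-≡ j₁ _ _ (trans (sym (+-assoc j₁ j₂ j)) (trans k+j≡ (sym (+-suc j₁ a))))
  j₁≢0 : ¬ (j₁ ≡ 0)
  j₁≢0 refl = <-irrefl (trans (sym (+-identityʳ z)) z+j₁≡) z<

window-upper< : ∀ R z k j → 1 ≤ k → k + j ≡ R → z + k < tri (suc R) → window z k + 2 ^ j < 2 ^ R
window-upper< zero z (suc k) j _ () _
window-upper< (suc R) z k j 1≤k k+j≡ h with tri (suc R) ≤? z
... | yes last with m≤n⇒∃[o]m+o≡n last
...   | v , refl with m≤n⇒∃[o]m+o≡n (+-cancelʳ-< k v j (<-≤-trans (in-last-row< R v k h) (≤-reflexive (trans (sym k+j≡) (+-comm k j)))))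
...   | i , refl = ≤-trans (≤-reflexive (cong (λ t → suc (window (tri (suc R) + v) k + 2 ^ t)) (sym (+-suc v i))))
          (window-upper-row< (suc R) v k (suc i) 1≤k (s≤s z≤n) (<⇒≤ (in-last-row< R v k h)) (trans (reorder v k i) k+j≡))
  where
  reorder : ∀ v k i → v + (k + suc i) ≡ k + (suc v + i)
  reorder = solve-∀
window-upper< (suc R) z k j 1≤k k+j≡ h | no not-last with z + k ≤? tri (suc R)
... | yes before = window-upper-before< R z k j 1≤k k+j≡ before
... | no crossing = window-upper-crossing< R z k j k+j≡ (≰⇒> not-last) (≰⇒> crossing)

-- With b₂ = tri r + u, the
-- edges of b₁ beyond e form a window of r − u edges inside K_(r+1).
carry-profit-large : ∀ r b₁ b₂ e → b₁ < tri (suc r) → b₂ < tri (suc r) → tri r ≤ b₂ →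
  b₁ + b₂ ≡ tri (suc r) + e → ℱ b₁ + ℱ b₂ < ℱ (tri (suc r)) + ℱ e
carry-profit-large r b₁ b₂ e b₁< b₂< tri≤b₂ sum≡ with m≤n⇒∃[o]m+o≡n tri≤b₂
... | u , refl with m≤n⇒∃[o]m+o≡n (+-cancelˡ-< (tri r) u r (<-≤-trans b₂< (≤-reflexive (tri-suc r))))
... | k' , u+k≡ with b₁≡ (tri r) u (suc k') r e b₁ (trans (+-suc u k') u+k≡) (trans sum≡ (cong (_+ e) (tri-suc r)))
  where
  b₁≡ : ∀ T u k r e b₁ → u + k ≡ r → b₁ + (T + u) ≡ T + r + e → b₁ ≡ e + k
  b₁≡ T u k r e b₁ u+k≡r eq = +-cancelʳ-≡ (T + u) _ _ (trans eq (trans (cong (λ t → T + t + e) (sym u+k≡r)) (regroup T u k e)))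
    where
    regroup : ∀ T u k e → T + (u + k) + e ≡ e + k + (T + u)
    regroup = solve-∀
... | refl = begin-strict
    ℱ (e + k) + ℱ (tri r + u) ≡⟨ cong₂ _+_ (ℱ-split e k) (ℱ-split (tri r) u) ⟩
    (ℱ e + window e k) + (ℱ (tri r) + window (tri r) u) ≡⟨ regroup₁ (ℱ e) (window e k) (ℱ (tri r)) (window (tri r) u) ⟩
    ℱ (tri r) + ℱ e + (window e k + window (tri r) u) <⟨ +-monoʳ-< (ℱ (tri r) + ℱ e) windows< ⟩
    ℱ (tri r) + ℱ e + window (tri r) r ≡⟨ regroup₂ (ℱ (tri r)) (ℱ e) (window (tri r) r) ⟩
    (ℱ (tri r) + window (tri r) r) + ℱ e ≡⟨ cong (_+ ℱ e) (sym (ℱ-tri-suc r)) ⟩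
    ℱ (tri (suc r)) + ℱ e ∎
  where
  open ≤-Reasoning
  k : ℕ
  k = suc k'
  u+k≡r : u + k ≡ r
  u+k≡r = trans (+-suc u k') u+k≡
  windows< : window e k + window (tri r) u < window (tri r) r
  windows< = +-cancelʳ-< 1 _ _ (begin-strict
      window e k + window (tri r) u + 1 ≡⟨ +-assoc (window e k) _ 1 ⟩
      window e k + (window (tri r) u + 1) ≡⟨ cong (window e k +_) (window-row₀ r u (≤-trans (m≤m+n u k) (≤-reflexive u+k≡r))) ⟩
      window e k + 2 ^ u <⟨ window-upper< r e k u (s≤s z≤n) (trans (+-comm k u) u+k≡r) b₁< ⟩
      2 ^ r ≡⟨ sym (window-row₀ r r ≤-refl) ⟩
      window (tri r) r + 1 ∎)
  regroup₁ : ∀ a b c d → (a + b) + (c + d) ≡ c + a + (b + d)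
  regroup₁ = solve-∀
  regroup₂ : ∀ a b c → a + b + c ≡ (a + c) + b
  regroup₂ = solve-∀

carry-profit : ∀ r b₁ b₂ e → 1 ≤ r → b₁ < tri (suc r) → b₂ < tri (suc r) →
  b₁ + b₂ ≡ tri (suc r) + e → ℱ b₁ + ℱ b₂ < ℱ (tri (suc r)) + ℱ e
carry-profit r b₁ b₂ e 1≤r b₁< b₂< sum≡ with tri r ≤? b₂
... | yes tri≤b₂ = carry-profit-large r b₁ b₂ e b₁< b₂< tri≤b₂ sum≡
... | no tri≰b₂ with tri r ≤? b₁
...   | yes tri≤b₁ = ≤-trans (≤-reflexive (cong suc (+-comm (ℱ b₁) (ℱ b₂))))
                       (carry-profit-large r b₂ b₁ e b₂< b₁< tri≤b₁ (trans (+-comm b₂ b₁) sum≡))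
...   | no tri≰b₁ = begin-strict
    ℱ b₁ + ℱ b₂ ≤⟨ +-mono-≤ (ℱ-mono (<⇒≤ (≰⇒> tri≰b₁))) (ℱ-mono (<⇒≤ (≰⇒> tri≰b₂))) ⟩
    ℱ (tri r) + ℱ (tri r) <⟨ +-monoʳ-< (ℱ (tri r)) (≤-trans (≤-reflexive (+-comm 1 (ℱ (tri r)))) (+-monoʳ-≤ (ℱ (tri r)) 1≤r)) ⟩
    ℱ (tri r) + (ℱ (tri r) + r) ≡⟨ cong (ℱ (tri r) +_) last-row ⟩
    ℱ (tri r) + window (tri r) r ≡⟨ sym (ℱ-tri-suc r) ⟩
    ℱ (tri (suc r)) ≤⟨ m≤m+n _ (ℱ e) ⟩
    ℱ (tri (suc r)) + ℱ e ∎
  where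
  open ≤-Reasoning
  last-row : ℱ (tri r) + r ≡ window (tri r) r
  last-row = +-cancelʳ-≡ 1 _ _ (trans (ℱ-tri r) (sym (window-row₀ r r ≤-refl)))

-- 6. Isomorphisms up to isolated vertices

record AdjIso {V W : Set} (A : V → V → Bool) (B : W → W → Bool) : Set where
  field
    to : V → W
    from : W → V
    to-from : ∀ y → to (from y) ≡ y
    from-to : ∀ x → from (to x) ≡ x
    preserves : ∀ u v → A u v ≡ B (to u) (to v)
open AdjIso

adjNI : (G : Graph) → NI G → NI G → Bool
adjNI G u v = adj G (proj₁ u) (proj₁ v)

toIsoUpToIsolated : ∀ {G H} → AdjIso (adjNI G) (adjNI H) → IsoUpToIsolated G H
toIsoUpToIsolated φ = mk↔ₛ′ (to φ) (from φ) (to-from φ) (from-to φ) , preserves φ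

≅-refl : ∀ {V : Set} (A : V → V → Bool) → AdjIso A A
≅-refl A = record { to = id ; from = id ; to-from = λ _ → refl ; from-to = λ _ → refl ; preserves = λ _ _ → refl }

≅-sym : ∀ {V W : Set} {A : V → V → Bool} {B : W → W → Bool} → AdjIso A B → AdjIso B A
≅-sym {A = A} {B} φ = record { to = from φ ; from = to φ ; to-from = from-to φ ; from-to = to-from φ
  ; preserves = λ u v → trans (cong₂ B (sym (to-from φ u)) (sym (to-from φ v))) (sym (preserves φ (from φ u) (from φ v))) }

≅-trans : ∀ {U V W : Set} {A : U → U → Bool} {B : V → V → Bool} {X : W → W → Bool} → AdjIso A B → AdjIso B X → AdjIso A X
≅-trans φ ψ = record { to = to ψ ∘ to φ ; from = from φ ∘ from ψ
  ; to-from = λ y → trans (cong (to ψ) (to-from φ (from ψ y))) (to-from ψ y)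
  ; from-to = λ x → trans (cong (from φ) (from-to ψ (to φ x))) (from-to φ x)
  ; preserves = λ u v → trans (preserves φ u v) (preserves ψ (to φ u) (to φ v)) }

infixr 5 _⊎ᵃ_
_⊎ᵃ_ : ∀ {V W : Set} → (V → V → Bool) → (W → W → Bool) → V ⊎ W → V ⊎ W → Bool
(A ⊎ᵃ B) (inj₁ x) (inj₁ y) = A x y
(A ⊎ᵃ B) (inj₂ x) (inj₂ y) = B x y
(A ⊎ᵃ B) _ _ = false

≅-⊎ : ∀ {V V' W W' : Set} {A : V → V → Bool} {A' : V' → V' → Bool} {B : W → W → Bool} {B' : W' → W' → Bool} →
  AdjIso A A' → AdjIso B B' → AdjIso (A ⊎ᵃ B) (A' ⊎ᵃ B')
≅-⊎ {A = A} {A'} {B} {B'} φ ψ = record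
  { to = map⊎ (to φ) (to ψ) ; from = map⊎ (from φ) (from ψ) ; to-from = tf ; from-to = ft ; preserves = pr }
  where
  tf : ∀ y → map⊎ (to φ) (to ψ) (map⊎ (from φ) (from ψ) y) ≡ y
  tf (inj₁ x) = cong inj₁ (to-from φ x)
  tf (inj₂ x) = cong inj₂ (to-from ψ x)
  ft : ∀ y → map⊎ (from φ) (from ψ) (map⊎ (to φ) (to ψ) y) ≡ y
  ft (inj₁ x) = cong inj₁ (from-to φ x)
  ft (inj₂ x) = cong inj₂ (from-to ψ x)
  pr : ∀ u v → (A ⊎ᵃ B) u v ≡ (A' ⊎ᵃ B') (map⊎ (to φ) (to ψ) u) (map⊎ (to φ) (to ψ) v)
  pr (inj₁ x) (inj₁ y) = preserves φ x y
  pr (inj₁ x) (inj₂ y) = refl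
  pr (inj₂ x) (inj₁ y) = refl
  pr (inj₂ x) (inj₂ y) = preserves ψ x y

≅-comm : ∀ {V W : Set} (A : V → V → Bool) (B : W → W → Bool) → AdjIso (A ⊎ᵃ B) (B ⊎ᵃ A)
≅-comm A B = record { to = swap ; from = swap ; to-from = swap-involutive ; from-to = swap-involutive ; preserves = pr }
  where
  pr : ∀ u v → (A ⊎ᵃ B) u v ≡ (B ⊎ᵃ A) (swap u) (swap v)
  pr (inj₁ x) (inj₁ y) = refl
  pr (inj₁ x) (inj₂ y) = refl
  pr (inj₂ x) (inj₁ y) = refl
  pr (inj₂ x) (inj₂ y) = refl

≅-assoc : ∀ {U V W : Set} (A : U → U → Bool) (B : V → V → Bool) (X : W → W → Bool) →
  AdjIso ((A ⊎ᵃ B) ⊎ᵃ X) (A ⊎ᵃ (B ⊎ᵃ X))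
≅-assoc A B X = record { to = assocʳ ; from = assocˡ ; to-from = tf ; from-to = ft ; preserves = pr }
  where
  tf : ∀ y → assocʳ (assocˡ y) ≡ y
  tf (inj₁ x) = refl
  tf (inj₂ (inj₁ x)) = refl
  tf (inj₂ (inj₂ x)) = refl
  ft : ∀ y → assocˡ (assocʳ y) ≡ y
  ft (inj₁ (inj₁ x)) = refl
  ft (inj₁ (inj₂ x)) = refl
  ft (inj₂ x) = refl
  pr : ∀ u v → ((A ⊎ᵃ B) ⊎ᵃ X) u v ≡ (A ⊎ᵃ (B ⊎ᵃ X)) (assocʳ u) (assocʳ v)
  pr (inj₁ (inj₁ x)) (inj₁ (inj₁ y)) = refl
  pr (inj₁ (inj₁ x)) (inj₁ (inj₂ y)) = refl
  pr (inj₁ (inj₁ x)) (inj₂ y) = refl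
  pr (inj₁ (inj₂ x)) (inj₁ (inj₁ y)) = refl
  pr (inj₁ (inj₂ x)) (inj₁ (inj₂ y)) = refl
  pr (inj₁ (inj₂ x)) (inj₂ y) = refl
  pr (inj₂ x) (inj₁ (inj₁ y)) = refl
  pr (inj₂ x) (inj₁ (inj₂ y)) = refl
  pr (inj₂ x) (inj₂ y) = refl

≅-unitˡ : ∀ {E V : Set} (Z : E → E → Bool) (A : V → V → Bool) → (E → ⊥) → AdjIso (Z ⊎ᵃ A) A
≅-unitˡ {E} Z A empty = record { to = [ ⊥-elim ∘ empty , id ]′ ; from = inj₂ ; to-from = λ _ → refl ; from-to = ft ; preserves = pr }
  where
  ft : ∀ y → inj₂ ([ ⊥-elim ∘ empty , id ]′ y) ≡ y
  ft (inj₁ x) = ⊥-elim (empty x)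
  ft (inj₂ x) = refl
  pr : ∀ u v → (Z ⊎ᵃ A) u v ≡ A ([ ⊥-elim ∘ empty , id ]′ u) ([ ⊥-elim ∘ empty , id ]′ v)
  pr (inj₁ x) _ = ⊥-elim (empty x)
  pr (inj₂ x) (inj₁ y) = ⊥-elim (empty y)
  pr (inj₂ x) (inj₂ y) = refl

≅-unitʳ : ∀ {E V : Set} (Z : E → E → Bool) (A : V → V → Bool) → (E → ⊥) → AdjIso (A ⊎ᵃ Z) A
≅-unitʳ Z A empty = ≅-trans (≅-comm A Z) (≅-unitˡ Z A empty)

≅-interchange : ∀ {P Q R S : Set} (A : P → P → Bool) (B : Q → Q → Bool) (X : R → R → Bool) (D : S → S → Bool) →
  AdjIso ((A ⊎ᵃ B) ⊎ᵃ (X ⊎ᵃ D)) ((A ⊎ᵃ X) ⊎ᵃ (B ⊎ᵃ D))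
≅-interchange A B X D = ≅-trans (≅-assoc A B (X ⊎ᵃ D))
  (≅-trans (≅-⊎ (≅-refl A) (≅-trans (≅-sym (≅-assoc B X D)) (≅-trans (≅-⊎ (≅-comm B X) (≅-refl D)) (≅-assoc X B D))))
  (≅-sym (≅-assoc A X (B ⊎ᵃ D))))

≅-swap₂₃ : ∀ {P Q S : Set} (A : P → P → Bool) (B : Q → Q → Bool) (X : S → S → Bool) → AdjIso ((A ⊎ᵃ B) ⊎ᵃ X) ((A ⊎ᵃ X) ⊎ᵃ B)
≅-swap₂₃ A B X = ≅-trans (≅-assoc A B X) (≅-trans (≅-⊎ (≅-refl A) (≅-comm B X)) (≅-sym (≅-assoc A X B)))

Σ-T-≡ : ∀ {X : Set} {b : X → Bool} {x x' : X} → x ≡ x' → (t : T (b x)) (t' : T (b x')) →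
  _≡_ {A = Σ X (λ z → T (b z))} (x , t) (x' , t')
Σ-T-≡ refl t t' = cong (_ ,_) (T-irrelevant t t')

orFin-+ : ∀ p q (g : Fin (p + q) → Bool) → orFin (p + q) g ≡ orFin p (λ i → g (i ↑ˡ q)) ∨ orFin q (λ j → g (p ↑ʳ j))
orFin-+ zero q g = refl
orFin-+ (suc p) q g = trans (cong (g fz ∨_) (orFin-+ p q (g ∘ fs))) (sym (∨-assoc (g fz) _ _))

nonIsolated⊎ : (G H : Graph) → Fin (n G) ⊎ Fin (n H) → Bool
nonIsolated⊎ G H = [ nonIsolated G , nonIsolated H ]′

nonIsolated-⊕ : ∀ G H x → nonIsolated (G ⊕ H) x ≡ nonIsolated⊎ G H (splitAt (n G) x)
nonIsolated-⊕ G H x = trans (any-allFin (n G + n H) _) (trans (orFin-+ (n G) (n H) _) (trans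
    (cong₂ _∨_ (orFin-cong (n G) (λ i → cong (⊕adj (adj G) (adj H) s) (splitAt-↑ˡ (n G) i (n H))))
               (orFin-cong (n H) (λ j → cong (⊕adj (adj G) (adj H) s) (splitAt-↑ʳ (n G) (n H) j))))
    (sides s)))
  where
  s : Fin (n G) ⊎ Fin (n H)
  s = splitAt (n G) x
  sides : ∀ s → orFin (n G) (λ i → ⊕adj (adj G) (adj H) s (inj₁ i)) ∨ orFin (n H) (λ j → ⊕adj (adj G) (adj H) s (inj₂ j))
              ≡ nonIsolated⊎ G H s
  sides (inj₁ i) = trans (cong (orFin (n G) (adj G i) ∨_) (orFin-false (n H))) (trans (∨-identityʳ _) (sym (any-allFin (n G) (adj G i))))
  sides (inj₂ j) = trans (cong (_∨ orFin (n H) (adj H j)) (orFin-false (n G))) (sym (any-allFin (n H) (adj H j)))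

NI⊎ : (G H : Graph) → Set
NI⊎ G H = Σ (Fin (n G) ⊎ Fin (n H)) (λ s → T (nonIsolated⊎ G H s))

adjNI⊎ : (G H : Graph) → NI⊎ G H → NI⊎ G H → Bool
adjNI⊎ G H u v = ⊕adj (adj G) (adj H) (proj₁ u) (proj₁ v)

NI⊕≅NI⊎ : ∀ G H → AdjIso (adjNI (G ⊕ H)) (adjNI⊎ G H)
NI⊕≅NI⊎ G H = record { to = to' ; from = from' ; to-from = tf ; from-to = ft ; preserves = λ _ _ → refl }
  where
  to' : NI (G ⊕ H) → NI⊎ G H
  to' (x , t) = splitAt (n G) x , subst T (nonIsolated-⊕ G H x) t
  from' : NI⊎ G H → NI (G ⊕ H)
  from' (s , t) = join (n G) (n H) s , subst T (sym (nonIsolated-⊕ G H (join (n G) (n H) s)))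
                    (subst (λ z → T (nonIsolated⊎ G H z)) (sym (splitAt-join (n G) (n H) s)) t)
  tf : ∀ y → to' (from' y) ≡ y
  tf (s , t) = Σ-T-≡ (splitAt-join (n G) (n H) s) _ t
  ft : ∀ y → from' (to' y) ≡ y
  ft (x , t) = Σ-T-≡ (join-splitAt (n G) (n H) x) _ t

NI⊎≅⊎ᵃ : ∀ G H → AdjIso (adjNI⊎ G H) (adjNI G ⊎ᵃ adjNI H)
NI⊎≅⊎ᵃ G H = record { to = to' ; from = from' ; to-from = tf ; from-to = ft ; preserves = pr }
  where
  to' : NI⊎ G H → NI G ⊎ NI H
  to' (inj₁ i , t) = inj₁ (i , t)
  to' (inj₂ j , t) = inj₂ (j , t)
  from' : NI G ⊎ NI H → NI⊎ G H
  from' (inj₁ (i , t)) = inj₁ i , t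
  from' (inj₂ (j , t)) = inj₂ j , t
  tf : ∀ y → to' (from' y) ≡ y
  tf (inj₁ _) = refl
  tf (inj₂ _) = refl
  ft : ∀ y → from' (to' y) ≡ y
  ft (inj₁ _ , _) = refl
  ft (inj₂ _ , _) = refl
  pr : ∀ u v → adjNI⊎ G H u v ≡ (adjNI G ⊎ᵃ adjNI H) (to' u) (to' v)
  pr (inj₁ _ , _) (inj₁ _ , _) = refl
  pr (inj₁ _ , _) (inj₂ _ , _) = refl
  pr (inj₂ _ , _) (inj₁ _ , _) = refl
  pr (inj₂ _ , _) (inj₂ _ , _) = refl

NI-⊕ : ∀ G H → AdjIso (adjNI (G ⊕ H)) (adjNI G ⊎ᵃ adjNI H)
NI-⊕ G H = ≅-trans (NI⊕≅NI⊎ G H) (NI⊎≅⊎ᵃ G H)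

NI-copies-+ : ∀ a₁ a₂ H → AdjIso (adjNI (copies (a₁ + a₂) H)) (adjNI (copies a₁ H) ⊎ᵃ adjNI (copies a₂ H))
NI-copies-+ zero a₂ H = ≅-sym (≅-unitˡ (adjNI emptyGraph) (adjNI (copies a₂ H)) λ ())
NI-copies-+ (suc a₁) a₂ H = ≅-trans (NI-⊕ H (copies (a₁ + a₂) H)) (≅-trans (≅-⊎ (≅-refl (adjNI H)) (NI-copies-+ a₁ a₂ H))
  (≅-trans (≅-sym (≅-assoc (adjNI H) (adjNI (copies a₁ H)) (adjNI (copies a₂ H)))) (≅-⊎ (≅-sym (NI-⊕ H (copies a₁ H))) (≅-refl _))))

colex0-NI : NI (Colex 0) → ⊥
colex0-NI (fz , ())

≅-sameAdj : ∀ {k} (A B : Fin k → Fin k → Bool) → (∀ i j → A i j ≡ B i j) → AdjIso (adjNI (mkGraph k A)) (adjNI (mkGraph k B))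
≅-sameAdj {k} A B A≡B = record
  { to = to' ; from = from' ; to-from = λ { (v , t) → Σ-T-≡ refl _ t } ; from-to = λ { (v , t) → Σ-T-≡ refl _ t }
  ; preserves = λ u v → A≡B (proj₁ u) (proj₁ v) }
  where
  same : ∀ v → any (A v) (allFin k) ≡ any (B v) (allFin k)
  same v = trans (any-allFin k (A v)) (trans (orFin-cong k (A≡B v)) (sym (any-allFin k (B v))))
  to' : NI (mkGraph k A) → NI (mkGraph k B)
  to' (v , t) = v , subst T (same v) t
  from' : NI (mkGraph k B) → NI (mkGraph k A)
  from' (v , t) = v , subst T (sym (same v)) t

colex1≅K2 : AdjIso (adjNI (Colex 1)) (adjNI (K 2))
colex1≅K2 = ≅-sameAdj _ _ same
  where
  same : ∀ (i j : Fin 2) → colexAdj 1 (toℕ i) (toℕ j) ≡ not ⌊ i ≟ j ⌋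
  same fz fz = refl
  same fz (fs fz) = refl
  same (fs fz) fz = refl
  same (fs fz) (fs fz) = refl

orFin-intro : ∀ k (g : Fin k → Bool) (i : Fin k) → T (g i) → T (orFin k g)
orFin-intro (suc k) g fz t = T∨₁ _ t
orFin-intro (suc k) g (fs i) t = T∨₂ (g fz) (orFin-intro k (g ∘ fs) i t)

orFin-elim : ∀ k (g : Fin k → Bool) → T (orFin k g) → Σ (Fin k) (λ i → T (g i))
orFin-elim (suc k) g t with T∨-elim (g fz) t
... | inj₁ t₁ = fz , t₁
... | inj₂ t₂ with orFin-elim k (g ∘ fs) t₂
... | i , tᵢ = fs i , tᵢ

nonIsolated-intro : ∀ G v w → T (adj G v w) → T (nonIsolated G v)
nonIsolated-intro G v w t = subst T (sym (any-allFin (n G) (adj G v))) (orFin-intro (n G) (adj G v) w t)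

nonIsolated-elim : ∀ G v → T (nonIsolated G v) → Σ (Fin (n G)) (λ w → T (adj G v w))
nonIsolated-elim G v t = orFin-elim (n G) (adj G v) (subst T (any-allFin (n G) (adj G v)) t)

stair-0-< : ∀ c i j → T (stair c 0 i j) → i < c
stair-0-< c i j t with T∨-elim ((i <ᵇ j) ∧ colexBelow c 0 i j) t
... | inj₁ t₁ = <-trans (<ᵇ⇒< i j (T∧₁ (i <ᵇ j) t₁)) (below-0 i j (T∧₂ (i <ᵇ j) t₁))
  where
  below-0 : ∀ i j → T (colexBelow c 0 i j) → j < c
  below-0 i j t with T∨-elim (j <ᵇ c) t
  ... | inj₁ t₁ = <ᵇ⇒< j c t₁
  ... | inj₂ t₂ = ⊥-elim (T∧₂ (j ≡ᵇ c) t₂)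
... | inj₂ t₂ with T∨-elim (i <ᵇ c) (T∧₂ (j <ᵇ i) t₂)
...   | inj₁ t₃ = <ᵇ⇒< i c t₃
...   | inj₂ t₃ = ⊥-elim (T∧₂ (i ≡ᵇ c) t₃)

stair-0-neighbour : ∀ c i → 2 ≤ c → i < c → Σ ℕ λ j → j < 2 × T (stair c 0 i j)
stair-0-neighbour c zero 2≤c _ = 1 , s≤s (s≤s z≤n) ,
  T∨₁ ((1 <ᵇ 0) ∧ colexBelow c 0 1 0) (T∧ {0 <ᵇ 1} tt (T∨₁ ((1 ≡ᵇ c) ∧ (0 <ᵇ 0)) (<⇒<ᵇ 2≤c)))
stair-0-neighbour c (suc i) _ i<c = 0 , s≤s z≤n ,
  T∨₂ ((suc i <ᵇ 0) ∧ colexBelow c 0 (suc i) 0) (T∧ {0 <ᵇ suc i} tt (T∨₁ ((suc i ≡ᵇ c) ∧ (0 <ᵇ 0)) (<⇒<ᵇ i<c)))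

c≤1+tri : ∀ c → c ≤ suc (tri c)
c≤1+tri zero = z≤n
c≤1+tri (suc c) = s≤s (≤-trans (m≤n+m c (tri c)) (≤-reflexive (sym (tri-suc c))))

module CompleteColex (c : ℕ) (2≤c : 2 ≤ c) where
  G : Graph
  G = Colex (tri c)

  colexAdj≡K : ∀ i j → colexAdj (tri c) i j ≡ stair c 0 i j
  colexAdj≡K i j = trans (cong (λ z → colexAdj z i j) (sym (+-identityʳ (tri c)))) (colexAdj≡stair c 0 (<-≤-trans (s≤s z≤n) 2≤c) i j)

  nonIsolated⇒< : ∀ v → T (nonIsolated G v) → toℕ v < c
  nonIsolated⇒< v t with nonIsolated-elim G v t
  ... | w , t-w = stair-0-< c (toℕ v) (toℕ w) (subst T (colexAdj≡K (toℕ v) (toℕ w)) t-w)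

  <⇒nonIsolated : ∀ v → toℕ v < c → T (nonIsolated G v)
  <⇒nonIsolated v v<c with stair-0-neighbour c (toℕ v) 2≤c v<c
  ... | j , j<2 , t-j = nonIsolated-intro G v w
        (subst T (sym (colexAdj≡K (toℕ v) (toℕ w))) (subst (λ z → T (stair c 0 (toℕ v) z)) (sym (toℕ-fromℕ< j<)) t-j))
    where
    j< : j < suc (tri c)
    j< = <-≤-trans j<2 (≤-trans 2≤c (c≤1+tri c))
    w : Fin (suc (tri c))
    w = fromℕ< j<

  K-nonIsolated : ∀ x → T (nonIsolated (K c) x)
  K-nonIsolated x with stair-0-neighbour c (toℕ x) 2≤c (toℕ<n x)
  ... | j , j<2 , t-j = nonIsolated-intro (K c) x y
        (subst T (sym (Kadj≡stair c x y)) (subst (λ z → T (stair c 0 (toℕ x) z)) (sym (toℕ-fromℕ< j<c)) t-j))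
    where
    j<c : j < c
    j<c = <-≤-trans j<2 2≤c
    y : Fin c
    y = fromℕ< j<c

  colex-tri≅K : AdjIso (adjNI G) (adjNI (K c))
  colex-tri≅K = record { to = to' ; from = from' ; to-from = tf ; from-to = ft ; preserves = pr }
    where
    c≤ : c ≤ suc (tri c)
    c≤ = c≤1+tri c
    to' : NI G → NI (K c)
    to' (v , t) = fromℕ< (nonIsolated⇒< v t) , K-nonIsolated _
    from' : NI (K c) → NI G
    from' (x , t) = inject≤ x c≤ , <⇒nonIsolated _ (subst (_< c) (sym (toℕ-inject≤ x c≤)) (toℕ<n x))
    tf : ∀ y → to' (from' y) ≡ y
    tf (x , t) = Σ-T-≡ (toℕ-injective (trans (toℕ-fromℕ< _) (toℕ-inject≤ x c≤))) _ t
    ft : ∀ y → from' (to' y) ≡ y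
    ft (v , t) = Σ-T-≡ (toℕ-injective (trans (toℕ-inject≤ _ c≤) (toℕ-fromℕ< _))) _ t
    pr : ∀ u v → adjNI G u v ≡ adjNI (K c) (to' u) (to' v)
    pr (u , tu) (v , tv) = trans (colexAdj≡K (toℕ u) (toℕ v))
      (sym (trans (Kadj≡stair c (fromℕ< (nonIsolated⇒< u tu)) (fromℕ< (nonIsolated⇒< v tv)))
        (cong₂ (stair c 0) (toℕ-fromℕ< (nonIsolated⇒< u tu)) (toℕ-fromℕ< (nonIsolated⇒< v tv)))))

open CompleteColex using (colex-tri≅K)

Merged : ℕ → ℕ → ℕ → ℕ → ℕ → Graph
Merged R a₁ b₁ a₂ b₂ = (copies a₁ (K R) ⊕ Colex b₁) ⊕ (copies a₂ (K R) ⊕ Colex b₂)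

Exceptional : (R a₁ b₁ a₂ b₂ a b : ℕ) → Set
Exceptional R a₁ b₁ a₂ b₂ a b =
  IsoUpToIsolated (Merged R a₁ b₁ a₂ b₂) (copies a (K R) ⊕ Colex b)
  ⊎ Σ ℕ (λ c → (c ≥ 2) × (b ≡ c C 2 + 1) × IsoUpToIsolated (Merged R a₁ b₁ a₂ b₂) (copies a (K R) ⊕ (K c ⊕ K 2)))

module MergedIsos (R a₁ a₂ : ℕ) where
  A₁ : NI (copies a₁ (K R)) → NI (copies a₁ (K R)) → Bool
  A₁ = adjNI (copies a₁ (K R))
  A₂ : NI (copies a₂ (K R)) → NI (copies a₂ (K R)) → Bool
  A₂ = adjNI (copies a₂ (K R))

  split : ∀ b₁ b₂ → AdjIso (adjNI (Merged R a₁ b₁ a₂ b₂)) ((A₁ ⊎ᵃ adjNI (Colex b₁)) ⊎ᵃ (A₂ ⊎ᵃ adjNI (Colex b₂)))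
  split b₁ b₂ = ≅-trans (NI-⊕ (copies a₁ (K R) ⊕ Colex b₁) (copies a₂ (K R) ⊕ Colex b₂))
    (≅-⊎ (NI-⊕ (copies a₁ (K R)) (Colex b₁)) (NI-⊕ (copies a₂ (K R)) (Colex b₂)))

  gather : ∀ H → AdjIso ((A₁ ⊎ᵃ A₂) ⊎ᵃ adjNI H) (adjNI (copies (a₁ + a₂) (K R) ⊕ H))
  gather H = ≅-trans (≅-⊎ (≅-sym (NI-copies-+ a₁ a₂ (K R))) (≅-refl _)) (≅-sym (NI-⊕ (copies (a₁ + a₂) (K R)) H))

  merged-0-left : ∀ b₂ → AdjIso (adjNI (Merged R a₁ 0 a₂ b₂)) (adjNI (copies (a₁ + a₂) (K R) ⊕ Colex b₂))
  merged-0-left b₂ = ≅-trans (split 0 b₂) (≅-trans (≅-⊎ (≅-unitʳ (adjNI (Colex 0)) A₁ colex0-NI) (≅-refl _))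
    (≅-trans (≅-sym (≅-assoc A₁ A₂ (adjNI (Colex b₂)))) (gather (Colex b₂))))

  merged-0-right : ∀ b₁ → AdjIso (adjNI (Merged R a₁ b₁ a₂ 0)) (adjNI (copies (a₁ + a₂) (K R) ⊕ Colex (b₁ + 0)))
  merged-0-right b₁ = subst (λ b → AdjIso (adjNI (Merged R a₁ b₁ a₂ 0)) (adjNI (copies (a₁ + a₂) (K R) ⊕ Colex b)))
    (sym (+-identityʳ b₁))
    (≅-trans (split b₁ 0) (≅-trans (≅-⊎ (≅-refl _) (≅-unitʳ (adjNI (Colex 0)) A₂ colex0-NI))
      (≅-trans (≅-swap₂₃ A₁ (adjNI (Colex b₁)) A₂) (gather (Colex b₁)))))

  gatherK : ∀ c → AdjIso ((A₁ ⊎ᵃ A₂) ⊎ᵃ (adjNI (K c) ⊎ᵃ adjNI (K 2))) (adjNI (copies (a₁ + a₂) (K R) ⊕ (K c ⊕ K 2)))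
  gatherK c = ≅-trans (≅-⊎ (≅-refl _) (≅-sym (NI-⊕ (K c) (K 2)))) (gather (K c ⊕ K 2))

  merged-edge-left : ∀ c → 2 ≤ c → AdjIso (adjNI (Merged R a₁ 1 a₂ (tri c))) (adjNI (copies (a₁ + a₂) (K R) ⊕ (K c ⊕ K 2)))
  merged-edge-left c 2≤c = ≅-trans (split 1 (tri c)) (≅-trans (≅-⊎ (≅-⊎ (≅-refl _) colex1≅K2) (≅-⊎ (≅-refl _) (colex-tri≅K c 2≤c)))
    (≅-trans (≅-interchange A₁ (adjNI (K 2)) A₂ (adjNI (K c)))
    (≅-trans (≅-⊎ (≅-refl _) (≅-comm (adjNI (K 2)) (adjNI (K c)))) (gatherK c))))

  merged-edge-right : ∀ c → 2 ≤ c → AdjIso (adjNI (Merged R a₁ (tri c) a₂ 1)) (adjNI (copies (a₁ + a₂) (K R) ⊕ (K c ⊕ K 2)))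
  merged-edge-right c 2≤c = ≅-trans (split (tri c) 1) (≅-trans (≅-⊎ (≅-⊎ (≅-refl _) (colex-tri≅K c 2≤c)) (≅-⊎ (≅-refl _) colex1≅K2))
    (≅-trans (≅-interchange A₁ (adjNI (K c)) A₂ (adjNI (K 2))) (gatherK c)))

  strict-unless-exceptional : ∀ b₁ b₂ → ¬ Exceptional R a₁ b₁ a₂ b₂ (a₁ + a₂) (b₁ + b₂) → ℱ b₁ + ℱ b₂ < ℱ (b₁ + b₂)
  strict-unless-exceptional b₁ b₂ ¬exc with b₁ ≤? b₂
  ... | yes b₁≤b₂ with ℱ-superadd-cases b₁ b₂ b₁≤b₂
  ...   | inj₁ strict = strict
  ...   | inj₂ (inj₁ refl) = ⊥-elim (¬exc (inj₁ (toIsoUpToIsolated (merged-0-left b₂))))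
  ...   | inj₂ (inj₂ (refl , c , 2≤c , refl)) =
          ⊥-elim (¬exc (inj₂ (c , 2≤c , +-comm 1 (tri c) , toIsoUpToIsolated (merged-edge-left c 2≤c))))
  strict-unless-exceptional b₁ b₂ ¬exc | no b₁≰b₂ with ℱ-superadd-cases b₂ b₁ (<⇒≤ (≰⇒> b₁≰b₂))
  ...   | inj₁ strict = subst₂ _<_ (+-comm (ℱ b₂) (ℱ b₁)) (cong ℱ (+-comm b₂ b₁)) strict
  ...   | inj₂ (inj₁ refl) = ⊥-elim (¬exc (inj₁ (toIsoUpToIsolated (merged-0-right b₁))))
  ...   | inj₂ (inj₂ (refl , c , 2≤c , refl)) =
          ⊥-elim (¬exc (inj₂ (c , 2≤c , refl , toIsoUpToIsolated (merged-edge-right c 2≤c))))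

divmod-unique : ∀ B a b a' b' → b < B → b' < B → a * B + b ≡ a' * B + b' → a ≡ a' × b ≡ b'
divmod-unique B zero b zero b' _ _ eq = refl , eq
divmod-unique B zero b (suc a') b' b< _ eq =
  ⊥-elim (<-irrefl refl (<-≤-trans b< (≤-trans (m≤m+n B (a' * B + b')) (≤-reflexive (trans (sym (+-assoc B _ _)) (sym eq))))))
divmod-unique B (suc a) b zero b' _ b'< eq =
  ⊥-elim (<-irrefl refl (<-≤-trans b'< (≤-trans (m≤m+n B (a * B + b)) (≤-reflexive (trans (sym (+-assoc B _ _)) eq)))))
divmod-unique B (suc a) b (suc a') b' b< b'< eq
  with divmod-unique B a b a' b' b< b'< (+-cancelˡ-≡ B _ _ (trans (sym (+-assoc B _ _)) (trans eq (+-assoc B _ _))))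
... | refl , refl = refl , refl

divmod-no-carry : ∀ T a₁ b₁ a₂ b₂ a b → b₁ + b₂ < T → b < T →
  (a₁ * T + b₁) + (a₂ * T + b₂) ≡ a * T + b → a₁ + a₂ ≡ a × b₁ + b₂ ≡ b
divmod-no-carry T a₁ b₁ a₂ b₂ a b no-carry b<T sum≡ =
  divmod-unique T (a₁ + a₂) (b₁ + b₂) a b no-carry b<T (trans (sym (regroup a₁ a₂ T b₁ b₂)) sum≡)
  where
  regroup : ∀ a₁ a₂ T x y → (a₁ * T + x) + (a₂ * T + y) ≡ (a₁ + a₂) * T + (x + y)
  regroup = solve-∀

divmod-carry : ∀ T a₁ b₁ a₂ b₂ a b e → b₁ < T → b₂ < T → b < T → T + e ≡ b₁ + b₂ →
  (a₁ * T + b₁) + (a₂ * T + b₂) ≡ a * T + b → suc (a₁ + a₂) ≡ a × e ≡ b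
divmod-carry T a₁ b₁ a₂ b₂ a b e b₁<T b₂<T b<T T+e≡ sum≡ =
  divmod-unique T (suc (a₁ + a₂)) e a b e<T b<T (trans (regroup a₁ a₂ T e) (trans (cong ((a₁ + a₂) * T +_) T+e≡)
    (trans (sym (distrib a₁ a₂ T b₁ b₂)) sum≡)))
  where
  e<T : e < T
  e<T = +-cancelˡ-< T e _ (≤-trans (≤-reflexive (cong suc T+e≡)) (+-mono-<-≤ b₁<T (<⇒≤ b₂<T)))
  regroup : ∀ a₁ a₂ T e → suc (a₁ + a₂) * T + e ≡ (a₁ + a₂) * T + (T + e)
  regroup = solve-∀
  distrib : ∀ a₁ a₂ T x y → (a₁ * T + x) + (a₂ * T + y) ≡ (a₁ + a₂) * T + (x + y)
  distrib = solve-∀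

κ-G₁+G₂ : ∀ R a₁ b₁ a₂ b₂ → κ (copies a₁ (K R) ⊕ Colex b₁) + κ (copies a₂ (K R) ⊕ Colex b₂)
  ≡ (a₁ + a₂) * ℱ (tri R) + (ℱ b₁ + ℱ b₂)
κ-G₁+G₂ R a₁ b₁ a₂ b₂ = trans (cong₂ _+_ (κ-extremal R a₁ b₁) (κ-extremal R a₂ b₂)) (regroup a₁ a₂ (ℱ (tri R)) (ℱ b₁) (ℱ b₂))
  where
  regroup : ∀ a₁ a₂ F x y → (a₁ * F + x) + (a₂ * F + y) ≡ (a₁ + a₂) * F + (x + y)
  regroup = solve-∀

-- Without carry, G = (a₁ + a₂)K_R ∪ C(b₁ + b₂) and only the colex parts differ.
κ-no-carry : ∀ R a₁ b₁ a₂ b₂ → ℱ b₁ + ℱ b₂ ≤ ℱ (b₁ + b₂) →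
  κ (copies a₁ (K R) ⊕ Colex b₁) + κ (copies a₂ (K R) ⊕ Colex b₂) ≤ κ (copies (a₁ + a₂) (K R) ⊕ Colex (b₁ + b₂))
κ-no-carry R a₁ b₁ a₂ b₂ ℱ≤ = subst₂ _≤_ (sym (κ-G₁+G₂ R a₁ b₁ a₂ b₂)) (sym (κ-extremal R (a₁ + a₂) (b₁ + b₂)))
  (+-monoʳ-≤ ((a₁ + a₂) * ℱ (tri R)) ℱ≤)

κ-no-carry< : ∀ R a₁ b₁ a₂ b₂ → ℱ b₁ + ℱ b₂ < ℱ (b₁ + b₂) →
  κ (copies a₁ (K R) ⊕ Colex b₁) + κ (copies a₂ (K R) ⊕ Colex b₂) < κ (copies (a₁ + a₂) (K R) ⊕ Colex (b₁ + b₂))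
κ-no-carry< R a₁ b₁ a₂ b₂ ℱ< = subst₂ _<_ (sym (κ-G₁+G₂ R a₁ b₁ a₂ b₂)) (sym (κ-extremal R (a₁ + a₂) (b₁ + b₂)))
  (+-monoʳ-< ((a₁ + a₂) * ℱ (tri R)) ℱ<)

κ-carry< : ∀ R a₁ b₁ a₂ b₂ e → ℱ b₁ + ℱ b₂ < ℱ (tri R) + ℱ e →
  κ (copies a₁ (K R) ⊕ Colex b₁) + κ (copies a₂ (K R) ⊕ Colex b₂) < κ (copies (suc (a₁ + a₂)) (K R) ⊕ Colex e)
κ-carry< R a₁ b₁ a₂ b₂ e ℱ< = subst₂ _<_ (sym (κ-G₁+G₂ R a₁ b₁ a₂ b₂))
  (trans (regroup (a₁ + a₂) (ℱ (tri R)) (ℱ e)) (sym (κ-extremal R (suc (a₁ + a₂)) e)))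
  (+-monoʳ-< ((a₁ + a₂) * ℱ (tri R)) ℱ<)
  where
  regroup : ∀ a F x → a * F + (F + x) ≡ suc a * F + x
  regroup = solve-∀

Conclusion : (R a₁ b₁ a₂ b₂ a b : ℕ) → Set
Conclusion R a₁ b₁ a₂ b₂ a b =
  (κ (copies a (K R) ⊕ Colex b) ≥ κ (copies a₁ (K R) ⊕ Colex b₁) + κ (copies a₂ (K R) ⊕ Colex b₂))
  × (¬ Exceptional R a₁ b₁ a₂ b₂ a b → κ (copies a (K R) ⊕ Colex b) > κ (copies a₁ (K R) ⊕ Colex b₁) + κ (copies a₂ (K R) ⊕ Colex b₂))

no-carry-case : ∀ R a₁ b₁ a₂ b₂ → Conclusion R a₁ b₁ a₂ b₂ (a₁ + a₂) (b₁ + b₂)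
no-carry-case R a₁ b₁ a₂ b₂ = κ-no-carry R a₁ b₁ a₂ b₂ (ℱ-superadditive b₁ b₂) ,
  λ ¬exc → κ-no-carry< R a₁ b₁ a₂ b₂ (MergedIsos.strict-unless-exceptional R a₁ a₂ b₁ b₂ ¬exc)

carry-case : ∀ r a₁ b₁ a₂ b₂ e → 1 ≤ r → b₁ < tri (r + 1) → b₂ < tri (r + 1) → tri (r + 1) + e ≡ b₁ + b₂ →
  Conclusion (r + 1) a₁ b₁ a₂ b₂ (suc (a₁ + a₂)) e
carry-case r a₁ b₁ a₂ b₂ e 1≤r b₁<T b₂<T T+e≡ = <⇒≤ gain , λ _ → gain
  where
  r+1≡ : r + 1 ≡ suc r
  r+1≡ = +-comm r 1
  gain : κ (copies a₁ (K (r + 1)) ⊕ Colex b₁) + κ (copies a₂ (K (r + 1)) ⊕ Colex b₂)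
       < κ (copies (suc (a₁ + a₂)) (K (r + 1)) ⊕ Colex e)
  gain = κ-carry< (r + 1) a₁ b₁ a₂ b₂ e (subst (λ R → ℱ b₁ + ℱ b₂ < ℱ (tri R) + ℱ e) (sym r+1≡)
           (carry-profit r b₁ b₂ e 1≤r (subst (λ R → b₁ < tri R) r+1≡ b₁<T) (subst (λ R → b₂ < tri R) r+1≡ b₂<T)
             (trans (sym T+e≡) (cong (λ R → tri R + e) r+1≡))))

lemma5p1 : (r m₁ m₂ a₁ b₁ a₂ b₂ a b : ℕ) → 1 ≤ r → 1 ≤ m₁ → m₁ ≤ m₂ →
    m₁ ≡ a₁ * ((r + 1) C 2) + b₁ → b₁ < (r + 1) C 2 →
    m₂ ≡ a₂ * ((r + 1) C 2) + b₂ → b₂ < (r + 1) C 2 →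
    m₁ + m₂ ≡ a * ((r + 1) C 2) + b → b < (r + 1) C 2 →
    (κ (copies a (K (r + 1)) ⊕ Colex b)
       ≥ κ (copies a₁ (K (r + 1)) ⊕ Colex b₁) + κ (copies a₂ (K (r + 1)) ⊕ Colex b₂))
    × (¬ (IsoUpToIsolated ((copies a₁ (K (r + 1)) ⊕ Colex b₁) ⊕ (copies a₂ (K (r + 1)) ⊕ Colex b₂))
                          (copies a (K (r + 1)) ⊕ Colex b)
          ⊎ Σ ℕ (λ c → (c ≥ 2) × (b ≡ c C 2 + 1) ×
              IsoUpToIsolated ((copies a₁ (K (r + 1)) ⊕ Colex b₁) ⊕ (copies a₂ (K (r + 1)) ⊕ Colex b₂))
                              (copies a (K (r + 1)) ⊕ (K c ⊕ K 2))))
       → κ (copies a (K (r + 1)) ⊕ Colex b)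
           > κ (copies a₁ (K (r + 1)) ⊕ Colex b₁) + κ (copies a₂ (K (r + 1)) ⊕ Colex b₂))
lemma5p1 r m₁ m₂ a₁ b₁ a₂ b₂ a b 1≤r _ _ refl b₁<T refl b₂<T sum≡ b<T with b₁ + b₂ <? tri (r + 1)
... | yes no-carry with divmod-no-carry (tri (r + 1)) a₁ b₁ a₂ b₂ a b no-carry b<T sum≡
...   | refl , refl = no-carry-case (r + 1) a₁ b₁ a₂ b₂
lemma5p1 r m₁ m₂ a₁ b₁ a₂ b₂ a b 1≤r _ _ refl b₁<T refl b₂<T sum≡ b<T | no carry
  with m≤n⇒∃[o]m+o≡n (≮⇒≥ carry)
... | e , T+e≡ with divmod-carry (tri (r + 1)) a₁ b₁ a₂ b₂ a b e b₁<T b₂<T b<T T+e≡ sum≡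
...   | refl , refl = carry-case r a₁ b₁ a₂ b₂ e 1≤r b₁<T b₂<T T+e≡
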